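{- Let $M$ be a list of positive even integers and let $a,b$ be positive integers such that either both are even or $a=b$. Suppose that $\mathcal{P}$ is an $(M)^*$-packing of $K_{a,b}$ with a leave of size $l$ whose only non-trivial component $H$ contains a path $P=[x_0,x_1,\ldots,x_t]$ of even length $t\geq 4$ such that the edges in $E(H)\setminus E(P)$ form a path and such that $x_1x_t\notin E(H)$. Let $S$ be the $(x_0,x_t)$-switch with origin $x_1$ (note $x_0,x_t$ lie in the same part of $K_{a,b}$), and let $\mathcal{P}'$ be the $(M)^*$-packing of $K_{a,b}$ obtained from $\mathcal{P}$ by performing $S$. If $S$ does not have terminus $x_{t-1}$, then the leave of $\mathcal{P}'$ has a decomposition into a $t$-cycle and an $(l-t)$-cycle, and the leave of $\mathcal{P}'$ has at least as many vertices of degree $4$ as the leave of $\mathcal{P}$.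
   Context: A graph is even if every vertex has even degree and odd if every vertex has odd degree; $K_{a,b}$ (complete bipartite, parts of sizes $a,b$) is even if $a,b$ are even and odd if $a=b$ is odd. For a list $M=m_1,\ldots,m_t$ and a graph $G$ that is even or odd, an $(M)^*$-packing of $G$ is a set of pairwise edge-disjoint subgraphs of $G$ consisting of cycles of lengths $m_1,\ldots,m_t$, together with a perfect matching of $G$ if $G$ is odd. Its leave is the spanning subgraph of $G$ consisting of the edges of $G$ in no member of the packing. The size of a graph is its number of edges; a non-trivial component is a component with at least one edge; an $x$-cycle is a cycle with $x$ edges; $[y_0,\ldots,y_q]$ denotes the path with edges $y_0y_1,\ldots,y_{q-1}y_q$. $\mathrm{Nbd}_L(x)$ is the neighbourhood of $x$ in $L$. Switches: Let $\mathcal{P}$ be an $(M)^*$-packing of $K_{a,b}$ with leave $L$ and let $\alpha,\beta$ be distinct vertices in the same part of $K_{a,b}$. Let $X=(\mathrm{Nbd}_L(\alpha)\cup\mathrm{Nbd}_L(\beta))\setminus((\mathrm{Nbd}_L(\alpha)\cap\mathrm{Nbd}_L(\beta))\cup\{\alpha,\beta\})$. There exists (and one fixes) a partition of $X$ into pairs such that for each pair $\{u,v\}$ there is an $(M)^*$-packing $\mathcal{P}'$ of $K_{a,b}$ whose leave $L'$ differs from $L$ only in that each of $\alpha u,\alpha v,\beta u,\beta v$ is an edge of $L'$ if and only if it is not an edge of $L$. For $u\in X$, the $(\alpha,\beta)$-switch with origin $u$ has terminus $v$, where $\{u,v\}$ is the pair containing $u$, and "the packing obtained by performing the switch" means such a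 packing $\mathcal{P}'$. -}

module Defs where

open import Data.Nat using (ℕ; zero; suc; _+_; _∸_; _≤_; _<_; _≡ᵇ_)
open import Data.Nat.DivMod using (_mod_)
open import Data.Nat.Divisibility using (_∣_)
open import Data.Fin using (Fin; toℕ) renaming (zero to fz; suc to fs)
import Data.Fin.Properties as FinP
open import Data.Sum using (_⊎_; inj₁; inj₂)
open import Data.Sum.Properties using (≡-dec)
open import Data.Bool using (Bool; true; false; _∧_; _∨_; not; _xor_; if_then_else_)
open import Data.Product using (Σ; _×_; ∃!)
open import Data.List using (List)
import Data.List
open import Data.Unit using (⊤)
open import Data.Empty using (⊥)
open import Function.Definitions using (Injective)
open import Relation.Nullary using (¬_)
open import Relation.Nullary.Decidable using (⌊_⌋)
open import Relation.Binary.PropositionalEquality using (_≡_; _≢_)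

Even : ℕ → Set
Even n = 2 ∣ n

Odd : ℕ → Set
Odd n = 2 ∣ suc n

-- The complete bipartite graph K_{a,b}: vertex set Fin a ⊎ Fin b,
-- left part = inj₁, right part = inj₂; every edge is a pair (i , j)
-- with i : Fin a, j : Fin b.  A spanning subgraph of K_{a,b} is given
-- by its (decidable) edge set.

V : ℕ → ℕ → Set
V a b = Fin a ⊎ Fin b

EdgeSet : ℕ → ℕ → Set
EdgeSet a b = Fin a → Fin b → Bool

_==V_ : ∀ {a b} → V a b → V a b → Bool
u ==V v = ⌊ ≡-dec FinP._≟_ FinP._≟_ u v ⌋

sameEdge : ∀ {a b} → V a b → V a b → V a b → V a b → Bool
sameEdge p q r s = ((p ==V r) ∧ (q ==V s)) ∨ ((p ==V s) ∧ (q ==V r))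

adjV : ∀ {a b} → EdgeSet a b → V a b → V a b → Bool
adjV E (inj₁ i) (inj₂ j) = E i j
adjV E (inj₂ j) (inj₁ i) = E i j
adjV E (inj₁ _) (inj₁ _) = false
adjV E (inj₂ _) (inj₂ _) = false

Cross : ∀ {a b} → V a b → V a b → Set
Cross (inj₁ _) (inj₂ _) = ⊤
Cross (inj₂ _) (inj₁ _) = ⊤
Cross (inj₁ _) (inj₁ _) = ⊥
Cross (inj₂ _) (inj₂ _) = ⊥

anyFin : ∀ {n} → (Fin n → Bool) → Bool
anyFin {zero}  f = false
anyFin {suc n} f = f fz ∨ anyFin (λ k → f (fs k))

count : ∀ {n} → (Fin n → Bool) → ℕ
count {zero}  f = 0
count {suc n} f = (if f fz then 1 else 0) + count (λ k → f (fs k))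

deg : ∀ {a b} → EdgeSet a b → V a b → ℕ
deg E (inj₁ i) = count (λ j → E i j)
deg E (inj₂ j) = count (λ i → E i j)

size : ∀ {a b} → EdgeSet a b → ℕ
size {a} {b} E = sumL (λ i → count (λ j → E i j))
  where
  sumL : ∀ {n} → (Fin n → ℕ) → ℕ
  sumL {zero} f = 0
  sumL {suc n} f = f fz + sumL (λ k → f (fs k))

numDeg4 : ∀ {a b} → EdgeSet a b → ℕ
numDeg4 E = count (λ i → deg E (inj₁ i) ≡ᵇ 4) + count (λ j → deg E (inj₂ j) ≡ᵇ 4)

next : (m : ℕ) → Fin m → Fin m
next (suc n) i = suc (toℕ i) mod suc n

record Cycle (a b m : ℕ) : Set where
  field
    vtx   : Fin m → V a b
    inj   : Injective _≡_ _≡_ vtx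
    three : 3 ≤ m
    cross : ∀ k → Cross (vtx k) (vtx (next m k))
open Cycle public

cycEdges : ∀ {a b m} → Cycle a b m → EdgeSet a b
cycEdges {m = m} C i j =
  anyFin (λ k → sameEdge (vtx C k) (vtx C (next m k)) (inj₁ i) (inj₂ j))

PerfectMatching : ∀ {a b} → EdgeSet a b → Set
PerfectMatching {a} {b} E =
  (∀ i → ∃! _≡_ (λ j → E i j ≡ true)) × (∀ j → ∃! _≡_ (λ i → E i j ≡ true))

-- K_{a,b} is an odd graph iff a and b are odd (degrees are b and a)
OddK : ℕ → ℕ → Set
OddK a b = Odd a × Odd b

record Packing (M : List ℕ) (a b : ℕ) : Set where
  field
    cyc      : (k : Fin (Data.List.length M)) → Cycle a b (Data.List.lookup M k)
    disj     : ∀ k k' → k ≢ k' → ∀ i j →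
               cycEdges (cyc k) i j ≡ true → cycEdges (cyc k') i j ≡ false
    matching : EdgeSet a b
    matchOdd : OddK a b → PerfectMatching matching
    matchEv  : ¬ OddK a b → ∀ i j → matching i j ≡ false
    matchDisj : ∀ k i j → matching i j ≡ true → cycEdges (cyc k) i j ≡ false
open Packing public

leave : ∀ {M a b} → Packing M a b → EdgeSet a b
leave P i j = not (anyFin (λ k → cycEdges (cyc P k) i j) ∨ matching P i j)

IsPath : ∀ {a b} → (ℕ → V a b) → ℕ → Set
IsPath x t = ∀ i j → i ≤ t → j ≤ t → x i ≡ x j → i ≡ j

PathEdge : ∀ {a b} → (ℕ → V a b) → ℕ → V a b → V a b → Set
PathEdge x t p q = Σ ℕ (λ k → k < t × sameEdge (x k) (x (suc k)) p q ≡ true)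

PathIn : ∀ {a b} → EdgeSet a b → (ℕ → V a b) → ℕ → Set
PathIn E x t = ∀ k → k < t → adjV E (x k) (x (suc k)) ≡ true

data Reach {a b} (E : EdgeSet a b) : V a b → V a b → Set where
  here : ∀ {u} → Reach E u u
  step : ∀ {u w v} → adjV E u w ≡ true → Reach E w v → Reach E u v

-- E has at most one non-trivial component (all non-isolated vertices are
-- mutually reachable); H is then the subgraph formed by all edges of E.
OneNontrivialComponent : ∀ {a b} → EdgeSet a b → Set
OneNontrivialComponent E =
  ∀ u v → 1 ≤ deg E u → 1 ≤ deg E v → Reach E u v

RestIsPath : ∀ {a b} → EdgeSet a b → (ℕ → V a b) → ℕ → Set
RestIsPath {a} {b} E x t =
  Σ ℕ λ s → Σ (ℕ → V a b) λ y → IsPath y s ×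
    (∀ i j → ((E i j ≡ true × ¬ PathEdge x t (inj₁ i) (inj₂ j))
               → PathEdge y s (inj₁ i) (inj₂ j))
           × (PathEdge y s (inj₁ i) (inj₂ j)
               → (E i j ≡ true × ¬ PathEdge x t (inj₁ i) (inj₂ j))))

inX : ∀ {a b} → EdgeSet a b → V a b → V a b → V a b → Bool
inX L α β u = (adjV L α u xor adjV L β u) ∧ not (u ==V α) ∧ not (u ==V β)

SwitchedLeave : ∀ {a b} → EdgeSet a b → EdgeSet a b →
                V a b → V a b → V a b → V a b → Set
SwitchedLeave L L' α β u v = ∀ i j →
  L' i j ≡ (L i j xor (sameEdge α u (inj₁ i) (inj₂ j) ∨ sameEdge α v (inj₁ i) (inj₂ j)
                      ∨ sameEdge β u (inj₁ i) (inj₂ j) ∨ sameEdge β v (inj₁ i) (inj₂ j)))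

-- the fixed partition of X into pairs {u, τ u} such that every pair is
-- realised by some (M)*-packing (the (α,β)-switches of P)
record SwitchPairing {M a b} (P : Packing M a b) (α β : V a b) : Set where
  field
    τ     : V a b → V a b
    τX    : ∀ u → inX (leave P) α β u ≡ true → inX (leave P) α β (τ u) ≡ true
    τne   : ∀ u → inX (leave P) α β u ≡ true → τ u ≢ u
    τinv  : ∀ u → inX (leave P) α β u ≡ true → τ (τ u) ≡ u
    τreal : ∀ u → inX (leave P) α β u ≡ true →
            Σ (Packing M a b) λ P' → SwitchedLeave (leave P) (leave P') α β u (τ u)
open SwitchPairing public

DecompTwoCycles : ∀ {a b} → EdgeSet a b → ℕ → ℕ → Set
DecompTwoCycles {a} {b} E m n =
  Σ (Cycle a b m) λ C₁ → Σ (Cycle a b n) λ C₂ →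
    ∀ i j → (E i j ≡ (cycEdges C₁ i j ∨ cycEdges C₂ i j))
          × ¬ (cycEdges C₁ i j ≡ true × cycEdges C₂ i j ≡ true)

-- The leave L of the packing has only even degrees: removing edge-disjoint cycles and, when
-- K_{a,b} is odd, a perfect matching from K_{a,b} preserves the parity of every degree. The path
-- P = x_0 … x_t has odd degree only at its ends, so the remaining edges of L form a path
-- Q = z_0 … z_s from x_0 to x_t, edge-disjoint from P, and N_L(x_0) = {x_1, z_1},
-- N_L(x_t) = {x_{t-1}, z_{s-1}}. The terminus v of the switch lies in X and is neither x_1 nor
-- x_{t-1}, so v is z_1 (adjacent to x_0 only) or z_{s-1} (adjacent to x_t only). Reading Q from the
-- end adjacent to v, the switch deletes x_0x_1 and the first edge of Q and adds x_tx_1 and the edge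
-- from v to the other end of Q: this closes x_1 … x_t into a t-cycle and Q minus its first vertex
-- into an s-cycle, and s = l - t. A switch changes degrees only at x_0 and x_t, which have degree 2
-- in L, so every vertex of degree 4 in L keeps degree 4.

module Submission where

open import Defs
open import Data.Nat using (ℕ; zero; suc; _+_; _*_; _∸_; _≤_; _<_; z≤n; s≤s; s≤s⁻¹; _<ᵇ_; _≡ᵇ_)
open import Data.Nat.Properties
open import Data.Nat.Divisibility using (divides)
open import Data.Nat.DivMod using (_%_; m<n⇒m%n≡m; n%n≡0)
open import Data.Fin using (Fin; toℕ; fromℕ; fromℕ<; inject₁; punchIn) renaming (zero to fz; suc to fs)
import Data.Fin.Properties as Finₚ
open import Data.Sum using (_⊎_; inj₁; inj₂)
import Data.Sum
open import Data.Sum.Properties using (≡-dec)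
open import Data.Bool using (Bool; true; false; _∧_; _∨_; not; _xor_; if_then_else_)
import Data.Bool.Properties as Boolₚ
open import Data.Product using (Σ-syntax; _×_; _,_; proj₁; proj₂; ∃-syntax; ∃!)
open import Data.List using (List; length)
open import Data.List.Relation.Unary.All using (All)
open import Data.Empty using (⊥; ⊥-elim)
open import Function.Base using (_∘_; case_of_)
open import Function.Bundles using (Equivalence)
open import Relation.Nullary using (¬_; Dec; yes; no)
open import Relation.Binary.Definitions using (tri<; tri≈; tri>)
open import Relation.Nullary.Decidable using (isYes≗does; dec-true; dec-false; toWitness)
open import Relation.Binary.PropositionalEquality
open import Algebra.Properties.Semiring.Sum +-*-semiring
  using (sum; sum-cong-≗; ∑-distrib-+; ∑-comm; sum-remove; sum-init-last)
open import Algebra.Bundles using (CommutativeRing)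
open import Data.Bool.Solver using (module ∨-∧-Solver)
open import Algebra.Properties.CommutativeSemigroup +-commutativeSemigroup using (interchange)
open import Algebra.Properties.CommutativeSemigroup
  (CommutativeRing.+-commutativeSemigroup Boolₚ.xor-∧-commutativeRing)
  using () renaming (interchange to xor-interchange)


⟦_⟧ : Bool → ℕ
⟦ b ⟧ = if b then 1 else 0

∨-true⁻ : ∀ x {y} → (x ∨ y) ≡ true → x ≡ true ⊎ y ≡ true
∨-true⁻ true  _ = inj₁ refl
∨-true⁻ false e = inj₂ e

∨-introˡ : ∀ {x} y → x ≡ true → (x ∨ y) ≡ true
∨-introˡ y refl = refl

∨-introʳ : ∀ x {y} → y ≡ true → (x ∨ y) ≡ true
∨-introʳ x refl = Boolₚ.∨-zeroʳ x

∧-true⁻ : ∀ x {y} → (x ∧ y) ≡ true → x ≡ true × y ≡ true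
∧-true⁻ true e = refl , e

∧-true⁺ : ∀ {x y} → x ≡ true → y ≡ true → (x ∧ y) ≡ true
∧-true⁺ refl refl = refl

xor-true⁻ : ∀ x y → (x xor y) ≡ true → x ≡ true ⊎ y ≡ true
xor-true⁻ true  _ _ = inj₁ refl
xor-true⁻ false _ e = inj₂ e

xor-true-excl : ∀ x y → (x xor y) ≡ true → x ≡ true → y ≡ false
xor-true-excl true false _ _ = refl

xor-solve : ∀ x {y z} → (x xor y) ≡ z → y ≡ (x xor z)
xor-solve false e = e
xor-solve true {y} e = trans (sym (Boolₚ.not-involutive y)) (cong not e)

xor-absorbs : ∀ x y → (x xor y) ≡ y → x ≡ false
xor-absorbs false y     _ = refl
xor-absorbs true  false ()
xor-absorbs true  true  ()

Bool-ext : {x y : Bool} → (x ≡ true → y ≡ true) → (y ≡ true → x ≡ true) → x ≡ y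
Bool-ext {true}  x⇒y y⇒x = sym (x⇒y refl)
Bool-ext {false} {true} x⇒y y⇒x = y⇒x refl
Bool-ext {false} {false} x⇒y y⇒x = refl

Disjointᵇ : Bool → Bool → Set
Disjointᵇ x y = x ≡ true → y ≡ true → ⊥

Disjointᵇ-∨ˡ : ∀ {x y z} → Disjointᵇ x z → Disjointᵇ y z → Disjointᵇ (x ∨ y) z
Disjointᵇ-∨ˡ {x} xz yz e with ∨-true⁻ x e
... | inj₁ ex = xz ex
... | inj₂ ey = yz ey

Disjointᵇ-∨ʳ : ∀ {x y z} → Disjointᵇ x y → Disjointᵇ x z → Disjointᵇ x (y ∨ z)
Disjointᵇ-∨ʳ {y = y} xy xz ex e with ∨-true⁻ y e
... | inj₁ ey = xy ex ey
... | inj₂ ez = xz ex ez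

xor-exchange : ∀ r d n → Disjointᵇ r d → Disjointᵇ (r ∨ d) n → ((r ∨ d) xor (d ∨ n)) ≡ (r ∨ n)
xor-exchange true  true  _     rd _  = ⊥-elim (rd refl refl)
xor-exchange true  false true  _  Ln = ⊥-elim (Ln refl refl)
xor-exchange true  false false _  _  = refl
xor-exchange false true  true  _  Ln = ⊥-elim (Ln refl refl)
xor-exchange false true  false _  _  = refl
xor-exchange false false n     _  _  = refl

⟦∨⟧ : ∀ x y → Disjointᵇ x y → ⟦ x ∨ y ⟧ ≡ ⟦ x ⟧ + ⟦ y ⟧
⟦∨⟧ true  true  d = ⊥-elim (d refl refl)
⟦∨⟧ true  false _ = refl
⟦∨⟧ false y     _ = refl

⟦⟧+⟦⟧-xor : ∀ x y → (x xor y) ≡ true → ⟦ x ⟧ + ⟦ y ⟧ ≡ 1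
⟦⟧+⟦⟧-xor true  false _ = refl
⟦⟧+⟦⟧-xor false true  _ = refl

⟦xor⟧-balance : ∀ f m → ⟦ f xor m ⟧ + ⟦ f ∧ m ⟧ ≡ ⟦ f ⟧ + ⟦ not f ∧ m ⟧
⟦xor⟧-balance true  true  = refl
⟦xor⟧-balance true  false = refl
⟦xor⟧-balance false true  = refl
⟦xor⟧-balance false false = refl

⟦⟧-partition : ∀ K A B → (A ≡ true → K ≡ true) → (B ≡ true → K ≡ true) → Disjointᵇ A B →
               ⟦ K ∧ not (A ∨ B) ⟧ + (⟦ A ⟧ + ⟦ B ⟧) ≡ ⟦ K ⟧
⟦⟧-partition true  false false _ _ _ = refl
⟦⟧-partition true  true  false _ _ _ = refl
⟦⟧-partition true  false true  _ _ _ = refl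
⟦⟧-partition true  true  true  _ _ d = ⊥-elim (d refl refl)
⟦⟧-partition false true  _     A⇒K _ _ = case A⇒K refl of λ ()
⟦⟧-partition false false true  _ B⇒K _ = case B⇒K refl of λ ()
⟦⟧-partition false false false _ _ _ = refl

odd? : ℕ → Bool
odd? zero    = false
odd? (suc n) = not (odd? n)

odd?-+ : ∀ m n → odd? (m + n) ≡ (odd? m xor odd? n)
odd?-+ zero    n = refl
odd?-+ (suc m) n = trans (cong not (odd?-+ m n)) (Boolₚ.not-distribˡ-xor (odd? m) (odd? n))

odd?-2* : ∀ n → odd? (2 * n) ≡ false
odd?-2* n = trans (cong (λ k → odd? (n + k)) (+-identityʳ n))
                  (trans (odd?-+ n n) (Boolₚ.xor-same (odd? n)))

odd?-⟦⟧ : ∀ x → odd? ⟦ x ⟧ ≡ x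
odd?-⟦⟧ true  = refl
odd?-⟦⟧ false = refl

odd?-⟦⟧+⟦⟧ : ∀ x y → odd? (⟦ x ⟧ + ⟦ y ⟧) ≡ (x xor y)
odd?-⟦⟧+⟦⟧ x y = trans (odd?-+ ⟦ x ⟧ ⟦ y ⟧) (cong₂ _xor_ (odd?-⟦⟧ x) (odd?-⟦⟧ y))

Even⇒¬odd? : ∀ {n} → Even n → odd? n ≡ false
Even⇒¬odd? (divides q refl) = go q
  where
  go : ∀ q → odd? (q * 2) ≡ false
  go zero    = refl
  go (suc q) = trans (Boolₚ.not-involutive _) (go q)

¬odd?⇒Even : ∀ n → odd? n ≡ false → Even n
¬odd?⇒Even zero          _ = divides 0 refl
¬odd?⇒Even (suc zero)    ()
¬odd?⇒Even (suc (suc n)) e with ¬odd?⇒Even n (trans (sym (Boolₚ.not-involutive _)) e)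
... | divides q n≡q*2 = divides (suc q) (cong (λ k → suc (suc k)) n≡q*2)

Even⇒¬Odd : ∀ {n} → Even n → ¬ Odd n
Even⇒¬Odd {n} e o = case trans (sym (Even⇒¬odd? o)) (cong not (Even⇒¬odd? e)) of λ ()

<ᵇ-true : ∀ {m n} → m < n → (m <ᵇ n) ≡ true
<ᵇ-true m<n = Equivalence.to Boolₚ.T-≡ (<⇒<ᵇ m<n)

<ᵇ-false : ∀ {m n} → n ≤ m → (m <ᵇ n) ≡ false
<ᵇ-false {m} {n} n≤m with m <ᵇ n in e
... | false = refl
... | true  = ⊥-elim (≤⇒≯ n≤m (<ᵇ⇒< m n (Equivalence.from Boolₚ.T-≡ e)))

≡ᵇ-≡ : ∀ {m n} → (m ≡ n) → (m ≡ᵇ n) ≡ true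
≡ᵇ-≡ {m} {n} m≡n = Equivalence.to Boolₚ.T-≡ (≡⇒≡ᵇ m n m≡n)

≡ᵇ-sound : ∀ m n → (m ≡ᵇ n) ≡ true → m ≡ n
≡ᵇ-sound m n e = ≡ᵇ⇒≡ m n (Equivalence.from Boolₚ.T-≡ e)

<ᵇ-suc : ∀ k j → (k <ᵇ suc j) ≡ ((k <ᵇ j) xor (j ≡ᵇ k))
<ᵇ-suc zero    zero    = refl
<ᵇ-suc zero    (suc j) = refl
<ᵇ-suc (suc k) zero    = refl
<ᵇ-suc (suc k) (suc j) = <ᵇ-suc k j


count≡sum : ∀ {n} (f : Fin n → Bool) → count f ≡ sum (λ k → ⟦ f k ⟧)
count≡sum {zero}  f = refl
count≡sum {suc n} f = cong (⟦ f fz ⟧ +_) (count≡sum (λ k → f (fs k)))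

sum-zero : ∀ {n} {f : Fin n → ℕ} → (∀ k → f k ≡ 0) → sum f ≡ 0
sum-zero {zero}  h = refl
sum-zero {suc n} h = cong₂ _+_ (h fz) (sum-zero (λ k → h (fs k)))

sum-ones : ∀ n → sum {n} (λ _ → 1) ≡ n
sum-ones zero    = refl
sum-ones (suc n) = cong suc (sum-ones n)

sum-δ : ∀ {n} (f : Fin n → ℕ) (i : Fin n) → (∀ k → k ≢ i → f k ≡ 0) → sum f ≡ f i
sum-δ {suc n} f i h = begin
  sum f                        ≡⟨ sum-remove {i = i} f ⟩
  f i + sum (λ k → f (punchIn i k)) ≡⟨ cong (f i +_) (sum-zero (λ k → h _ (Finₚ.punchInᵢ≢i i k))) ⟩
  f i + 0                      ≡⟨ +-identityʳ (f i) ⟩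
  f i                          ∎
  where open ≡-Reasoning

sum-toℕ-δ : ∀ {n j} (f : ℕ → ℕ) → j < n → (∀ k → k < n → k ≢ j → f k ≡ 0) →
            sum {n} (λ r → f (toℕ r)) ≡ f j
sum-toℕ-δ f j<n off-j =
  trans (sum-δ (λ r → f (toℕ r)) (fromℕ< j<n)
               (λ r r≢j → off-j (toℕ r) (Finₚ.toℕ<n r)
                                (λ e → r≢j (Finₚ.toℕ-injective (trans e (sym (Finₚ.toℕ-fromℕ< j<n)))))))
        (cong f (Finₚ.toℕ-fromℕ< j<n))

sum-toℕ-zero : ∀ {n} (f : ℕ → ℕ) → (∀ k → k < n → f k ≡ 0) → sum {n} (λ r → f (toℕ r)) ≡ 0
sum-toℕ-zero f h = sum-zero (λ r → h (toℕ r) (Finₚ.toℕ<n r))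

odd?-sum : ∀ {n} {f : Fin n → ℕ} → (∀ k → odd? (f k) ≡ false) → odd? (sum f) ≡ false
odd?-sum {zero}  h = refl
odd?-sum {suc n} {f} h = trans (odd?-+ (f fz) _) (cong₂ _xor_ (h fz) (odd?-sum (λ k → h (fs k))))

count-unique : ∀ {n} (f : Fin n → Bool) → ∃! _≡_ (λ j → f j ≡ true) → count f ≡ 1
count-unique f (j , fj , unique) =
  trans (count≡sum f) (trans (sum-δ _ j off-j) (cong ⟦_⟧ fj))
  where
  off-j : ∀ k → k ≢ j → ⟦ f k ⟧ ≡ 0
  off-j k k≢j with f k in fk
  ... | true  = ⊥-elim (k≢j (sym (unique fk)))
  ... | false = refl

count-mono : ∀ {n} (f g : Fin n → Bool) → (∀ k → f k ≡ true → g k ≡ true) → count f ≤ count g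
count-mono {zero}  f g f⇒g = z≤n
count-mono {suc n} f g f⇒g with f fz in f0 | g fz in g0
... | true  | true  = s≤s (count-mono _ _ (λ k → f⇒g (fs k)))
... | true  | false = case trans (sym (f⇒g fz f0)) g0 of λ ()
... | false | true  = m≤n⇒m≤1+n (count-mono _ _ (λ k → f⇒g (fs k)))
... | false | false = count-mono _ _ (λ k → f⇒g (fs k))

anyFin-sound : ∀ {n} (g : Fin n → Bool) → anyFin g ≡ true → ∃[ r ] g r ≡ true
anyFin-sound {suc n} g e with ∨-true⁻ (g fz) e
... | inj₁ e₀ = fz , e₀
... | inj₂ e₁ = let r , gr = anyFin-sound (λ k → g (fs k)) e₁ in fs r , gr

anyFin-complete : ∀ {n} (g : Fin n → Bool) (r : Fin n) → g r ≡ true → anyFin g ≡ true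
anyFin-complete g fz     e = cong (_∨ anyFin (λ k → g (fs k))) e
anyFin-complete g (fs r) e =
  trans (cong (g fz ∨_) (anyFin-complete (λ k → g (fs k)) r e)) (Boolₚ.∨-zeroʳ (g fz))

anyFin-cong : ∀ {n} {g h : Fin n → Bool} → (∀ r → g r ≡ h r) → anyFin g ≡ anyFin h
anyFin-cong {zero}  e = refl
anyFin-cong {suc n} e = cong₂ _∨_ (e fz) (anyFin-cong (λ k → e (fs k)))

anyFin-false : ∀ {n} {g : Fin n → Bool} → (∀ r → g r ≡ false) → anyFin g ≡ false
anyFin-false {zero}  h = refl
anyFin-false {suc n} h = cong₂ _∨_ (h fz) (anyFin-false (λ k → h (fs k)))

∧-anyFin : ∀ {n} c (g : Fin n → Bool) → (c ∧ anyFin g) ≡ anyFin (λ r → c ∧ g r)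
∧-anyFin true  g = refl
∧-anyFin false g = sym (anyFin-false {g = λ r → false ∧ g r} (λ _ → refl))

⟦anyFin⟧ : ∀ {n} (g : Fin n → Bool) → (∀ r r' → r ≢ r' → g r ≡ true → g r' ≡ false) →
           ⟦ anyFin g ⟧ ≡ sum (λ r → ⟦ g r ⟧)
⟦anyFin⟧ {zero}  g h = refl
⟦anyFin⟧ {suc n} g h with g fz in e
... | true  = cong suc (sym (sum-zero (λ k → cong ⟦_⟧ (h fz (fs k) (λ ()) e))))
... | false = ⟦anyFin⟧ (λ k → g (fs k)) (λ r r' r≢r' → h (fs r) (fs r') (r≢r' ∘ Finₚ.suc-injective))

anyFin-init-last : ∀ {n} (f : Fin (suc n) → Bool) → anyFin f ≡ (anyFin (λ k → f (inject₁ k)) ∨ f (fromℕ n))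
anyFin-init-last {zero}  f = Boolₚ.∨-identityʳ (f fz)
anyFin-init-last {suc n} f =
  trans (cong (f fz ∨_) (anyFin-init-last (λ k → f (fs k))))
        (sym (Boolₚ.∨-assoc (f fz) (anyFin (λ k → f (fs (inject₁ k)))) (f (fs (fromℕ n)))))


module _ {a b : ℕ} where

  _≟V_ : (u w : V a b) → Dec (u ≡ w)
  _≟V_ = ≡-dec Finₚ._≟_ Finₚ._≟_

  ==V-sound : {u w : V a b} → (u ==V w) ≡ true → u ≡ w
  ==V-sound {u} {w} e = toWitness (Equivalence.from Boolₚ.T-≡ e)

  ==V-complete : {u w : V a b} → u ≡ w → (u ==V w) ≡ true
  ==V-complete {u} {w} e = trans (isYes≗does (u ≟V w)) (dec-true (u ≟V w) e)

  ==V-refl : (u : V a b) → (u ==V u) ≡ true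
  ==V-refl u = ==V-complete refl

  ==V-≢ : {u w : V a b} → u ≢ w → (u ==V w) ≡ false
  ==V-≢ {u} {w} ne = trans (isYes≗does (u ≟V w)) (dec-false (u ≟V w) ne)

  isLeft : V a b → Bool
  isLeft (inj₁ _) = true
  isLeft (inj₂ _) = false

  crossᵇ : V a b → V a b → Bool
  crossᵇ u w = isLeft u xor isLeft w

  crossᵇ-sym : (u w : V a b) → crossᵇ u w ≡ crossᵇ w u
  crossᵇ-sym u w = Boolₚ.xor-comm (isLeft u) (isLeft w)

  crossᵇ⇒Cross : (u w : V a b) → crossᵇ u w ≡ true → Cross u w
  crossᵇ⇒Cross (inj₁ _) (inj₂ _) _ = _
  crossᵇ⇒Cross (inj₂ _) (inj₁ _) _ = _

  Cross⇒crossᵇ : (u w : V a b) → Cross u w → crossᵇ u w ≡ true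
  Cross⇒crossᵇ (inj₁ _) (inj₂ _) _ = refl
  Cross⇒crossᵇ (inj₂ _) (inj₁ _) _ = refl

  adjV⇒crossᵇ : (E : EdgeSet a b) (u w : V a b) → adjV E u w ≡ true → crossᵇ u w ≡ true
  adjV⇒crossᵇ E (inj₁ _) (inj₂ _) _ = refl
  adjV⇒crossᵇ E (inj₂ _) (inj₁ _) _ = refl

  adjV-sym : (E : EdgeSet a b) (u w : V a b) → adjV E u w ≡ adjV E w u
  adjV-sym E (inj₁ _) (inj₁ _) = refl
  adjV-sym E (inj₁ _) (inj₂ _) = refl
  adjV-sym E (inj₂ _) (inj₁ _) = refl
  adjV-sym E (inj₂ _) (inj₂ _) = refl

  sameEdge-sound : (p q u w : V a b) → sameEdge p q u w ≡ true →
                   (p ≡ u × q ≡ w) ⊎ (p ≡ w × q ≡ u)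
  sameEdge-sound p q u w e with ∨-true⁻ ((p ==V u) ∧ (q ==V w)) e
  ... | inj₁ e₁ = let pu , qw = ∧-true⁻ (p ==V u) e₁ in inj₁ (==V-sound pu , ==V-sound qw)
  ... | inj₂ e₂ = let pw , qu = ∧-true⁻ (p ==V w) e₂ in inj₂ (==V-sound pw , ==V-sound qu)

  sameEdge-refl : (p q : V a b) → sameEdge p q p q ≡ true
  sameEdge-refl p q rewrite ==V-refl p | ==V-refl q = refl

  sameEdge-symʳ : (p q u w : V a b) → sameEdge p q u w ≡ sameEdge p q w u
  sameEdge-symʳ p q u w = Boolₚ.∨-comm ((p ==V u) ∧ (q ==V w)) _

  sameEdge-symˡ : (p q u w : V a b) → sameEdge p q u w ≡ sameEdge q p u w
  sameEdge-symˡ p q u w =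
    trans (cong₂ _∨_ (Boolₚ.∧-comm (p ==V u) _) (Boolₚ.∧-comm (p ==V w) _))
          (Boolₚ.∨-comm ((q ==V w) ∧ (p ==V u)) _)

  sameEdge-crossᵇ : (p q u w : V a b) → sameEdge p q u w ≡ true → crossᵇ u w ≡ crossᵇ p q
  sameEdge-crossᵇ p q u w e with sameEdge-sound p q u w e
  ... | inj₁ (refl , refl) = refl
  ... | inj₂ (refl , refl) = crossᵇ-sym q p

  sameEdge-unique : (p q r s u w : V a b) → sameEdge p q u w ≡ true → sameEdge r s u w ≡ true →
                    (p ≡ r × q ≡ s) ⊎ (p ≡ s × q ≡ r)
  sameEdge-unique p q r s u w e₁ e₂ with sameEdge-sound p q u w e₁ | sameEdge-sound r s u w e₂
  ... | inj₁ (refl , refl) | inj₁ (refl , refl) = inj₁ (refl , refl)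
  ... | inj₁ (refl , refl) | inj₂ (refl , refl) = inj₂ (refl , refl)
  ... | inj₂ (refl , refl) | inj₁ (refl , refl) = inj₂ (refl , refl)
  ... | inj₂ (refl , refl) | inj₂ (refl , refl) = inj₁ (refl , refl)

  adjV-sameEdge : (E : EdgeSet a b) (p q : V a b) (i : Fin a) (j : Fin b) →
                  sameEdge p q (inj₁ i) (inj₂ j) ≡ true → E i j ≡ adjV E p q
  adjV-sameEdge E p q i j e with sameEdge-sound p q _ _ e
  ... | inj₁ (refl , refl) = refl
  ... | inj₂ (refl , refl) = refl

  sumV : (V a b → ℕ) → ℕ
  sumV h = sum (λ i → h (inj₁ i)) + sum (λ j → h (inj₂ j))

  sumV-cong : {f g : V a b → ℕ} → (∀ w → f w ≡ g w) → sumV f ≡ sumV g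
  sumV-cong h = cong₂ _+_ (sum-cong-≗ (λ i → h (inj₁ i))) (sum-cong-≗ (λ j → h (inj₂ j)))

  sumV-+ : (f g : V a b → ℕ) → sumV (λ w → f w + g w) ≡ sumV f + sumV g
  sumV-+ f g = trans (cong₂ _+_ (∑-distrib-+ (λ i → f (inj₁ i)) (λ i → g (inj₁ i)))
                                 (∑-distrib-+ (λ j → f (inj₂ j)) (λ j → g (inj₂ j))))
                     (interchange (sum (λ i → f (inj₁ i))) _ _ _)

  sumV-zero : {f : V a b → ℕ} → (∀ w → f w ≡ 0) → sumV f ≡ 0
  sumV-zero h = cong₂ _+_ (sum-zero (λ i → h (inj₁ i))) (sum-zero (λ j → h (inj₂ j)))

  sumV-comm : ∀ {n} (h : Fin n → V a b → ℕ) →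
              sumV (λ w → sum (λ r → h r w)) ≡ sum (λ r → sumV (h r))
  sumV-comm h = trans (cong₂ _+_ (∑-comm (λ i r → h r (inj₁ i))) (∑-comm (λ j r → h r (inj₂ j))))
                      (sym (∑-distrib-+ (λ r → sum (λ i → h r (inj₁ i))) (λ r → sum (λ j → h r (inj₂ j)))))

  sumV-δ : (f : V a b → ℕ) (q : V a b) → (∀ w → w ≢ q → f w ≡ 0) → sumV f ≡ f q
  sumV-δ f (inj₁ i) h =
    trans (cong₂ _+_ (sum-δ (λ k → f (inj₁ k)) i (λ k k≢i → h _ (λ { refl → k≢i refl })))
                     (sum-zero (λ j → h (inj₂ j) (λ ()))))
          (+-identityʳ _)
  sumV-δ f (inj₂ j) h =
    cong₂ _+_ (sum-zero (λ i → h (inj₁ i) (λ ())))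
              (sum-δ (λ k → f (inj₂ k)) j (λ k k≢j → h _ (λ { refl → k≢j refl })))

  deg≡sumV : (E : EdgeSet a b) (u : V a b) → deg E u ≡ sumV (λ w → ⟦ adjV E u w ⟧)
  deg≡sumV E (inj₁ i) =
    trans (count≡sum (E i)) (cong (_+ sum (λ j → ⟦ E i j ⟧)) (sym (sum-zero {a} (λ _ → refl))))
  deg≡sumV E (inj₂ j) = trans (count≡sum (λ i → E i j))
    (sym (trans (cong (sum (λ i → ⟦ E i j ⟧) +_) (sum-zero {b} (λ _ → refl))) (+-identityʳ _)))

  sumV-δᵇ : (g : V a b → Bool) (p : V a b) → sumV (λ w → ⟦ g w ∧ (p ==V w) ⟧) ≡ ⟦ g p ⟧
  sumV-δᵇ g p =
    trans (sumV-δ _ p (λ w w≢p → cong ⟦_⟧ (trans (cong (g w ∧_) (==V-≢ (w≢p ∘ sym))) (Boolₚ.∧-zeroʳ (g w)))))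
          (cong ⟦_⟧ (trans (cong (g p ∧_) (==V-refl p)) (Boolₚ.∧-identityʳ (g p))))

  sum-left-indicator : (p : V a b) → sum (λ i → ⟦ p ==V inj₁ i ⟧) ≡ ⟦ isLeft p ⟧
  sum-left-indicator (inj₁ i₀) =
    trans (sum-δ (λ i → ⟦ inj₁ i₀ ==V inj₁ i ⟧) i₀ (λ i i≢i₀ → cong ⟦_⟧ (==V-≢ (λ { refl → i≢i₀ refl }))))
          (cong ⟦_⟧ (==V-refl (inj₁ i₀)))
  sum-left-indicator (inj₂ j₀) = sum-zero {a} (λ i → cong ⟦_⟧ (==V-≢ {u = inj₂ j₀} {w = inj₁ i} (λ ())))

  sumV-two-points : (g : V a b → Bool) {α β : V a b} → α ≢ β →
    sumV (λ w → ⟦ g w ∧ ((α ==V w) ∨ (β ==V w)) ⟧) ≡ ⟦ g α ⟧ + ⟦ g β ⟧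
  sumV-two-points g {α} {β} α≢β = begin
    sumV (λ w → ⟦ g w ∧ ((α ==V w) ∨ (β ==V w)) ⟧)
      ≡⟨ sumV-cong (λ w → trans (cong ⟦_⟧ (Boolₚ.∧-distribˡ-∨ (g w) (α ==V w) _))
                                (⟦∨⟧ (g w ∧ (α ==V w)) _ (not-both w))) ⟩
    sumV (λ w → ⟦ g w ∧ (α ==V w) ⟧ + ⟦ g w ∧ (β ==V w) ⟧)
      ≡⟨ sumV-+ (λ w → ⟦ g w ∧ (α ==V w) ⟧) (λ w → ⟦ g w ∧ (β ==V w) ⟧) ⟩
    sumV (λ w → ⟦ g w ∧ (α ==V w) ⟧) + sumV (λ w → ⟦ g w ∧ (β ==V w) ⟧)
      ≡⟨ cong₂ _+_ (sumV-δᵇ g α) (sumV-δᵇ g β) ⟩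
    ⟦ g α ⟧ + ⟦ g β ⟧ ∎
    where
    open ≡-Reasoning
    not-both : ∀ w → Disjointᵇ (g w ∧ (α ==V w)) (g w ∧ (β ==V w))
    not-both w e₁ e₂ =
      α≢β (trans (==V-sound (proj₂ (∧-true⁻ (g w) e₁))) (sym (==V-sound (proj₂ (∧-true⁻ (g w) e₂)))))

  sumV-toggle : (f : V a b → Bool) {α β : V a b} → α ≢ β → (f α xor f β) ≡ true →
    sumV (λ w → ⟦ f w xor ((α ==V w) ∨ (β ==V w)) ⟧) ≡ sumV (λ w → ⟦ f w ⟧)
  sumV-toggle f {α} {β} α≢β differ = +-cancelʳ-≡ 1 _ _ (begin
    sumV (λ w → ⟦ f w xor m w ⟧) + 1
      ≡⟨ cong (sumV (λ w → ⟦ f w xor m w ⟧) +_)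
              (trans (sym (⟦⟧+⟦⟧-xor (f α) (f β) differ)) (sym (sumV-two-points f α≢β))) ⟩
    sumV (λ w → ⟦ f w xor m w ⟧) + sumV (λ w → ⟦ f w ∧ m w ⟧)
      ≡⟨ sym (sumV-+ (λ w → ⟦ f w xor m w ⟧) (λ w → ⟦ f w ∧ m w ⟧)) ⟩
    sumV (λ w → ⟦ f w xor m w ⟧ + ⟦ f w ∧ m w ⟧)
      ≡⟨ sumV-cong (λ w → ⟦xor⟧-balance (f w) (m w)) ⟩
    sumV (λ w → ⟦ f w ⟧ + ⟦ not (f w) ∧ m w ⟧)
      ≡⟨ sumV-+ (λ w → ⟦ f w ⟧) (λ w → ⟦ not (f w) ∧ m w ⟧) ⟩
    sumV (λ w → ⟦ f w ⟧) + sumV (λ w → ⟦ not (f w) ∧ m w ⟧)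
      ≡⟨ cong (sumV (λ w → ⟦ f w ⟧) +_)
              (trans (sumV-two-points (λ w → not (f w)) α≢β)
                     (⟦⟧+⟦⟧-xor (not (f α)) (not (f β)) (trans (Boolₚ.xor-annihilates-not (f α) (f β)) differ))) ⟩
    sumV (λ w → ⟦ f w ⟧) + 1 ∎)
    where
    open ≡-Reasoning
    m : V a b → Bool
    m w = (α ==V w) ∨ (β ==V w)

degK : ∀ {a b} → V a b → ℕ
degK {a} {b} (inj₁ _) = b
degK {a} {b} (inj₂ _) = a

degK-square : ∀ {a} (u : V a a) → degK u ≡ a
degK-square (inj₁ _) = refl
degK-square (inj₂ _) = refl

sumV-crossᵇ : ∀ {a b} (u : V a b) → sumV (λ w → ⟦ crossᵇ u w ⟧) ≡ degK u
sumV-crossᵇ {a} {b} (inj₁ _) = cong₂ _+_ (sum-zero {a} (λ _ → refl)) (sum-ones b)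
sumV-crossᵇ {a} {b} (inj₂ _) = trans (cong₂ _+_ (sum-ones a) (sum-zero {b} (λ _ → refl))) (+-identityʳ a)

module _ {a b : ℕ} where

  sameEdge-degree : (p q u : V a b) → p ≢ q →
                    sumV (λ w → ⟦ sameEdge p q u w ⟧) ≡ ⟦ p ==V u ⟧ + ⟦ q ==V u ⟧
  sameEdge-degree p q u p≢q = begin
    sumV (λ w → ⟦ sameEdge p q u w ⟧)
      ≡⟨ sumV-cong (λ w → trans (⟦∨⟧ ((p ==V u) ∧ (q ==V w)) _ (not-both w))
                                (cong (λ c → ⟦ (p ==V u) ∧ (q ==V w) ⟧ + ⟦ c ⟧) (Boolₚ.∧-comm (p ==V w) _))) ⟩
    sumV (λ w → ⟦ (p ==V u) ∧ (q ==V w) ⟧ + ⟦ (q ==V u) ∧ (p ==V w) ⟧)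
      ≡⟨ sumV-+ (λ w → ⟦ (p ==V u) ∧ (q ==V w) ⟧) (λ w → ⟦ (q ==V u) ∧ (p ==V w) ⟧) ⟩
    sumV (λ w → ⟦ (p ==V u) ∧ (q ==V w) ⟧) + sumV (λ w → ⟦ (q ==V u) ∧ (p ==V w) ⟧)
      ≡⟨ cong₂ _+_ (sumV-δᵇ (λ _ → p ==V u) q) (sumV-δᵇ (λ _ → q ==V u) p) ⟩
    ⟦ p ==V u ⟧ + ⟦ q ==V u ⟧ ∎
    where
    open ≡-Reasoning
    not-both : ∀ w → Disjointᵇ ((p ==V u) ∧ (q ==V w)) ((p ==V w) ∧ (q ==V u))
    not-both w e₁ e₂ =
      p≢q (trans (==V-sound (proj₁ (∧-true⁻ (p ==V u) e₁))) (sym (==V-sound (proj₂ (∧-true⁻ (p ==V w) e₂)))))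

  crossᵇ∧sameEdge-degree : (p q u : V a b) → p ≢ q →
    sumV (λ w → ⟦ crossᵇ u w ∧ sameEdge p q u w ⟧) ≡ ⟦ crossᵇ p q ⟧ * (⟦ p ==V u ⟧ + ⟦ q ==V u ⟧)
  crossᵇ∧sameEdge-degree p q u p≢q with crossᵇ p q in pq
  ... | true  = trans (sumV-cong (λ w → cong ⟦_⟧ (same-weight w)))
                      (trans (sameEdge-degree p q u p≢q) (sym (+-identityʳ _)))
    where
    same-weight : ∀ w → (crossᵇ u w ∧ sameEdge p q u w) ≡ sameEdge p q u w
    same-weight w with sameEdge p q u w in e
    ... | true  = trans (Boolₚ.∧-identityʳ _) (trans (sameEdge-crossᵇ p q u w e) pq)
    ... | false = Boolₚ.∧-zeroʳ _
  ... | false = sumV-zero (λ w → cong ⟦_⟧ (no-weight w))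
    where
    no-weight : ∀ w → (crossᵇ u w ∧ sameEdge p q u w) ≡ false
    no-weight w with sameEdge p q u w in e
    ... | true  = trans (Boolₚ.∧-identityʳ _) (trans (sameEdge-crossᵇ p q u w e) pq)
    ... | false = Boolₚ.∧-zeroʳ _

  pairEdges : ∀ {n} → (Fin n → V a b) → (Fin n → V a b) → V a b → V a b → Bool
  pairEdges p q u w = anyFin (λ r → sameEdge (p r) (q r) u w)

  DistinctPairs : ∀ {n} → (Fin n → V a b) → (Fin n → V a b) → Set
  DistinctPairs p q = (∀ r r' → p r ≡ p r' → r ≡ r') × (∀ r r' → p r ≡ q r' → q r ≡ p r' → ⊥)

  pairEdges-degree : ∀ {n} (p q : Fin n → V a b) → DistinctPairs p q → (u : V a b) →
    sumV (λ w → ⟦ crossᵇ u w ∧ pairEdges p q u w ⟧) ≡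
    sum (λ r → ⟦ crossᵇ (p r) (q r) ⟧ * (⟦ p r ==V u ⟧ + ⟦ q r ==V u ⟧))
  pairEdges-degree p q (p-inj , no-flip) u = begin
    sumV (λ w → ⟦ crossᵇ u w ∧ pairEdges p q u w ⟧)
      ≡⟨ sumV-cong (λ w → trans (cong ⟦_⟧ (∧-anyFin (crossᵇ u w) (λ r → sameEdge (p r) (q r) u w)))
                                   (⟦anyFin⟧ _ (at-most-one w))) ⟩
    sumV (λ w → sum (λ r → ⟦ crossᵇ u w ∧ sameEdge (p r) (q r) u w ⟧))
      ≡⟨ sumV-comm (λ r w → ⟦ crossᵇ u w ∧ sameEdge (p r) (q r) u w ⟧) ⟩
    sum (λ r → sumV (λ w → ⟦ crossᵇ u w ∧ sameEdge (p r) (q r) u w ⟧))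
      ≡⟨ sum-cong-≗ (λ r → crossᵇ∧sameEdge-degree (p r) (q r) u (λ e → no-flip r r e (sym e))) ⟩
    sum (λ r → ⟦ crossᵇ (p r) (q r) ⟧ * (⟦ p r ==V u ⟧ + ⟦ q r ==V u ⟧)) ∎
    where
    open ≡-Reasoning
    at-most-one : ∀ w r r' → r ≢ r' → (crossᵇ u w ∧ sameEdge (p r) (q r) u w) ≡ true →
                  (crossᵇ u w ∧ sameEdge (p r') (q r') u w) ≡ false
    at-most-one w r r' r≢r' e with sameEdge (p r') (q r') u w in e'
    ... | false = Boolₚ.∧-zeroʳ _
    ... | true with sameEdge-unique _ _ _ _ u w (proj₂ (∧-true⁻ (crossᵇ u w) e)) e'
    ...   | inj₁ (same , _)  = ⊥-elim (r≢r' (p-inj r r' same))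
    ...   | inj₂ (pq , qp) = ⊥-elim (no-flip r r' pq qp)

  adjV≡crossᵇ∧ : (E : EdgeSet a b) (F : V a b → V a b → Bool) → (∀ u w → F u w ≡ F w u) →
                 (∀ i j → E i j ≡ F (inj₁ i) (inj₂ j)) → ∀ u w → adjV E u w ≡ (crossᵇ u w ∧ F u w)
  adjV≡crossᵇ∧ E F F-sym E≡F (inj₁ i) (inj₁ j) = refl
  adjV≡crossᵇ∧ E F F-sym E≡F (inj₁ i) (inj₂ j) = E≡F i j
  adjV≡crossᵇ∧ E F F-sym E≡F (inj₂ j) (inj₁ i) = trans (E≡F i j) (F-sym _ _)
  adjV≡crossᵇ∧ E F F-sym E≡F (inj₂ i) (inj₂ j) = refl

  pairEdges-sym : ∀ {n} (p q : Fin n → V a b) u w → pairEdges p q u w ≡ pairEdges p q w u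
  pairEdges-sym p q u w = anyFin-cong (λ r → sameEdge-symʳ (p r) (q r) u w)


-- Cycles

toℕ-next-< : ∀ {n} (r : Fin (suc n)) → toℕ r < n → toℕ (next (suc n) r) ≡ suc (toℕ r)
toℕ-next-< {n} r r<n = trans (Finₚ.toℕ-fromℕ< _) (m<n⇒m%n≡m (s≤s r<n))

toℕ-next-≡ : ∀ {n} (r : Fin (suc n)) → toℕ r ≡ n → toℕ (next (suc n) r) ≡ 0
toℕ-next-≡ {n} r r≡n =
  trans (Finₚ.toℕ-fromℕ< _) (trans (cong (λ k → suc k % suc n) r≡n) (n%n≡0 (suc n)))

next-inject₁ : ∀ {n} (k : Fin n) → next (suc n) (inject₁ k) ≡ fs k
next-inject₁ k = Finₚ.toℕ-injective
  (trans (toℕ-next-< (inject₁ k) (subst (_< _) (sym (Finₚ.toℕ-inject₁ k)) (Finₚ.toℕ<n k)))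
         (cong suc (Finₚ.toℕ-inject₁ k)))

next-fromℕ : ∀ n → next (suc n) (fromℕ n) ≡ fz
next-fromℕ n = Finₚ.toℕ-injective (toℕ-next-≡ (fromℕ n) (Finₚ.toℕ-fromℕ n))

next-next-≢ : ∀ m (r : Fin m) → 3 ≤ m → next m (next m r) ≢ r
next-next-≢ (suc n) r (s≤s 2≤n) e with m≤n⇒m<n∨m≡n (s≤s⁻¹ (Finₚ.toℕ<n r))
... | inj₂ r≡n = <⇒≢ 2≤n (trans (sym r₂≡1) (trans (cong toℕ e) r≡n))
  where
  r₁≡0 = toℕ-next-≡ r r≡n
  r₂≡1 = trans (toℕ-next-< (next (suc n) r) (subst (_< n) (sym r₁≡0) (≤-trans (s≤s z≤n) 2≤n)))
               (cong suc r₁≡0)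
... | inj₁ r<n with m≤n⇒m<n∨m≡n r<n
...   | inj₁ r+1<n = m≢2+m (trans (sym (cong toℕ e)) r₂≡)
  where
  r₁≡ = toℕ-next-< r r<n
  r₂≡ = trans (toℕ-next-< (next (suc n) r) (subst (_< n) (sym r₁≡) r+1<n)) (cong suc r₁≡)
  m≢2+m : ∀ {m} → m ≢ suc (suc m)
  m≢2+m ()
...   | inj₂ r+1≡n = <⇒≢ 2≤n (trans (cong suc (sym r≡0)) r+1≡n)
  where
  r≡0 = trans (sym (cong toℕ e)) (toℕ-next-≡ (next (suc n) r) (trans (toℕ-next-< r r<n) r+1≡n))

sum-rotate : ∀ m (f : Fin m → ℕ) → sum (λ r → f (next m r)) ≡ sum f
sum-rotate zero    f = refl
sum-rotate (suc n) f = begin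
  sum (λ r → f (next (suc n) r))
    ≡⟨ sum-init-last (λ r → f (next (suc n) r)) ⟩
  sum (λ k → f (next (suc n) (inject₁ k))) + f (next (suc n) (fromℕ n))
    ≡⟨ cong₂ _+_ (sum-cong-≗ (λ k → cong f (next-inject₁ k))) (cong f (next-fromℕ n)) ⟩
  sum (λ k → f (fs k)) + f fz
    ≡⟨ +-comm (sum (λ k → f (fs k))) (f fz) ⟩
  sum f ∎
  where open ≡-Reasoning

module _ {a b : ℕ} where

  cycle-distinct : ∀ {m} (C : Cycle a b m) → DistinctPairs (vtx C) (λ r → vtx C (next m r))
  cycle-distinct {m} C = (λ r r' → inj C) , no-flip
    where
    no-flip : ∀ r r' → vtx C r ≡ vtx C (next m r') → vtx C (next m r) ≡ vtx C r' → ⊥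
    no-flip r r' e₁ e₂ = next-next-≢ m r' (three C) (trans (cong (next m) (sym (inj C e₁))) (inj C e₂))

  adjV-cycEdges : ∀ {m} (C : Cycle a b m) u w →
    adjV (cycEdges C) u w ≡ (crossᵇ u w ∧ pairEdges (vtx C) (λ r → vtx C (next m r)) u w)
  adjV-cycEdges {m} C = adjV≡crossᵇ∧ (cycEdges C) _ (pairEdges-sym (vtx C) _) (λ i j → refl)

  cycle-degree : ∀ {m} (C : Cycle a b m) (u : V a b) →
                 deg (cycEdges C) u ≡ 2 * sum (λ r → ⟦ vtx C r ==V u ⟧)
  cycle-degree {m} C u = begin
    deg (cycEdges C) u
      ≡⟨ deg≡sumV (cycEdges C) u ⟩
    sumV (λ w → ⟦ adjV (cycEdges C) u w ⟧)
      ≡⟨ sumV-cong (λ w → cong ⟦_⟧ (adjV-cycEdges C u w)) ⟩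
    sumV (λ w → ⟦ crossᵇ u w ∧ pairEdges (vtx C) (λ r → vtx C (next m r)) u w ⟧)
      ≡⟨ pairEdges-degree _ _ (cycle-distinct C) u ⟩
    sum (λ r → ⟦ crossᵇ (vtx C r) (vtx C (next m r)) ⟧ * (occ r + occ (next m r)))
      ≡⟨ sum-cong-≗ (λ r → trans (cong (λ c → ⟦ c ⟧ * (occ r + occ (next m r)))
                                        (Cross⇒crossᵇ _ _ (cross C r)))
                                  (+-identityʳ _)) ⟩
    sum (λ r → occ r + occ (next m r))
      ≡⟨ ∑-distrib-+ occ (λ r → occ (next m r)) ⟩
    sum occ + sum (λ r → occ (next m r))
      ≡⟨ cong (sum occ +_) (sum-rotate m occ) ⟩
    sum occ + sum occ
      ≡⟨ cong (sum occ +_) (sym (+-identityʳ (sum occ))) ⟩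
    2 * sum occ ∎
    where
    open ≡-Reasoning
    occ : Fin m → ℕ
    occ r = ⟦ vtx C r ==V u ⟧


-- The leave has only even degrees

module _ {M : List ℕ} {a b : ℕ} (P : Packing M a b) where

  private
    inCycle : Fin (length M) → V a b → V a b → Bool
    inCycle k = adjV (cycEdges (cyc P k))

    inCycles inMatching : V a b → V a b → Bool
    inCycles u w = anyFin (λ k → inCycle k u w)
    inMatching = adjV (matching P)

    adjV-leave : ∀ u w → adjV (leave P) u w ≡ (crossᵇ u w ∧ not (inCycles u w ∨ inMatching u w))
    adjV-leave (inj₁ _) (inj₁ _) = refl
    adjV-leave (inj₁ _) (inj₂ _) = refl
    adjV-leave (inj₂ _) (inj₁ _) = refl
    adjV-leave (inj₂ _) (inj₂ _) = refl

    cycles-disjoint : ∀ u w k k' → k ≢ k' → inCycle k u w ≡ true → inCycle k' u w ≡ false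
    cycles-disjoint (inj₁ i) (inj₂ j) k k' k≢k' = disj P k k' k≢k' i j
    cycles-disjoint (inj₂ j) (inj₁ i) k k' k≢k' = disj P k k' k≢k' i j

    cycles-matching-disjoint : ∀ u w → Disjointᵇ (inCycles u w) (inMatching u w)
    cycles-matching-disjoint u w e m with anyFin-sound (λ k → inCycle k u w) e
    ... | k , ek = case trans (sym ek) (disjoint u w k m) of λ ()
      where
      disjoint : ∀ u w k → inMatching u w ≡ true → inCycle k u w ≡ false
      disjoint (inj₁ i) (inj₂ j) k = matchDisj P k i j
      disjoint (inj₂ j) (inj₁ i) k = matchDisj P k i j

  degree-balance : ∀ u →
    deg (leave P) u + (sum (λ k → deg (cycEdges (cyc P k)) u) + deg (matching P) u) ≡ degK u
  degree-balance u = begin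
    deg (leave P) u + (sum (λ k → deg (cycEdges (cyc P k)) u) + deg (matching P) u)
      ≡⟨ cong₂ _+_ (deg≡sumV (leave P) u)
                   (cong₂ _+_ (sum-cong-≗ (λ k → deg≡sumV (cycEdges (cyc P k)) u)) (deg≡sumV (matching P) u)) ⟩
    sumV ⟦leave⟧ + (sum (λ k → sumV (λ w → ⟦ inCycle k u w ⟧)) + sumV ⟦matching⟧)
      ≡⟨ cong (λ s → sumV ⟦leave⟧ + (s + sumV ⟦matching⟧)) (sym (sumV-comm (λ k w → ⟦ inCycle k u w ⟧))) ⟩
    sumV ⟦leave⟧ + (sumV ⟦cycles⟧ + sumV ⟦matching⟧)
      ≡⟨ cong (sumV ⟦leave⟧ +_) (sym (sumV-+ ⟦cycles⟧ ⟦matching⟧)) ⟩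
    sumV ⟦leave⟧ + sumV (λ w → ⟦cycles⟧ w + ⟦matching⟧ w)
      ≡⟨ sym (sumV-+ ⟦leave⟧ (λ w → ⟦cycles⟧ w + ⟦matching⟧ w)) ⟩
    sumV (λ w → ⟦leave⟧ w + (⟦cycles⟧ w + ⟦matching⟧ w))
      ≡⟨ sumV-cong pointwise ⟩
    sumV (λ w → ⟦ crossᵇ u w ⟧)
      ≡⟨ sumV-crossᵇ u ⟩
    degK u ∎
    where
    open ≡-Reasoning
    ⟦leave⟧ ⟦cycles⟧ ⟦matching⟧ : V a b → ℕ
    ⟦leave⟧ w = ⟦ adjV (leave P) u w ⟧
    ⟦cycles⟧ w = sum (λ k → ⟦ inCycle k u w ⟧)
    ⟦matching⟧ w = ⟦ inMatching u w ⟧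
    pointwise : ∀ w → ⟦leave⟧ w + (⟦cycles⟧ w + ⟦matching⟧ w) ≡ ⟦ crossᵇ u w ⟧
    pointwise w = begin
      ⟦leave⟧ w + (⟦cycles⟧ w + ⟦matching⟧ w)
        ≡⟨ cong₂ (λ l c → l + (c + ⟦matching⟧ w)) (cong ⟦_⟧ (adjV-leave u w))
                 (sym (⟦anyFin⟧ (λ k → inCycle k u w) (cycles-disjoint u w))) ⟩
      ⟦ crossᵇ u w ∧ not (inCycles u w ∨ inMatching u w) ⟧ + (⟦ inCycles u w ⟧ + ⟦matching⟧ w)
        ≡⟨ ⟦⟧-partition (crossᵇ u w) (inCycles u w) (inMatching u w)
             (λ e → let k , ek = anyFin-sound (λ k → inCycle k u w) e in adjV⇒crossᵇ _ u w ek)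
             (adjV⇒crossᵇ _ u w) (cycles-matching-disjoint u w) ⟩
      ⟦ crossᵇ u w ⟧ ∎

  matching-degree-odd : OddK a b → ∀ u → deg (matching P) u ≡ 1
  matching-degree-odd o (inj₁ i) = count-unique _ (proj₁ (matchOdd P o) i)
  matching-degree-odd o (inj₂ j) = count-unique _ (proj₂ (matchOdd P o) j)

  matching-degree-even : ¬ OddK a b → ∀ u → deg (matching P) u ≡ 0
  matching-degree-even ¬o (inj₁ i) =
    trans (count≡sum (matching P i)) (sum-zero (λ j → cong ⟦_⟧ (matchEv P ¬o i j)))
  matching-degree-even ¬o (inj₂ j) =
    trans (count≡sum (λ i → matching P i j)) (sum-zero (λ i → cong ⟦_⟧ (matchEv P ¬o i j)))

  K-matching-same-parity : (Even a × Even b) ⊎ a ≡ b → ∀ u → odd? (degK u) ≡ odd? (deg (matching P) u)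
  K-matching-same-parity (inj₁ (even-a , even-b)) u =
    trans (K-even u) (cong odd? (sym (matching-degree-even (λ (odd-a , _) → Even⇒¬Odd even-a odd-a) u)))
    where
    K-even : ∀ u → odd? (degK u) ≡ false
    K-even (inj₁ _) = Even⇒¬odd? even-b
    K-even (inj₂ _) = Even⇒¬odd? even-a
  K-matching-same-parity (inj₂ refl) u with odd? a in odd?-a
  ... | false =
    trans (cong odd? (degK-square u)) (trans odd?-a (cong odd? (sym (matching-degree-even ¬odd u))))
    where
    ¬odd : ¬ OddK a a
    ¬odd (odd-a , _) = Even⇒¬Odd (¬odd?⇒Even a odd?-a) odd-a
  ... | true =
    trans (cong odd? (degK-square u)) (trans odd?-a (cong odd? (sym (matching-degree-odd (odd-a , odd-a) u))))
    where
    odd-a : Odd a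
    odd-a = ¬odd?⇒Even (suc a) (cong not odd?-a)

  leave-degree-even : (Even a × Even b) ⊎ a ≡ b → ∀ u → odd? (deg (leave P) u) ≡ false
  leave-degree-even hab u = xor-absorbs (odd? (deg (leave P) u)) (odd? (deg (matching P) u)) (begin
    odd? (deg (leave P) u) xor odd? (deg (matching P) u)
      ≡⟨ cong (λ c → odd? (deg (leave P) u) xor (c xor odd? (deg (matching P) u))) cycles-even ⟨
    odd? (deg (leave P) u) xor (odd? cycles xor odd? (deg (matching P) u))
      ≡⟨ cong (odd? (deg (leave P) u) xor_) (odd?-+ cycles _) ⟨
    odd? (deg (leave P) u) xor odd? (cycles + deg (matching P) u)
      ≡⟨ odd?-+ (deg (leave P) u) _ ⟨
    odd? (deg (leave P) u + (cycles + deg (matching P) u))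
      ≡⟨ cong odd? (degree-balance u) ⟩
    odd? (degK u)
      ≡⟨ K-matching-same-parity hab u ⟩
    odd? (deg (matching P) u) ∎)
    where
    open ≡-Reasoning
    cycles = sum (λ k → deg (cycEdges (cyc P k)) u)
    cycles-even : odd? cycles ≡ false
    cycles-even = odd?-sum {f = λ k → deg (cycEdges (cyc P k)) u}
      (λ k → trans (cong odd? (cycle-degree (cyc P k) u)) (odd?-2* (sum (λ r → ⟦ vtx (cyc P k) r ==V u ⟧))))


-- Paths

module _ {a b : ℕ} where

  pathEdges : (ℕ → V a b) → ℕ → V a b → V a b → Bool
  pathEdges z n = pairEdges {n = n} (λ r → z (toℕ r)) (λ r → z (suc (toℕ r)))

  pathEdges-sound : (z : ℕ → V a b) (n : ℕ) {u w : V a b} → pathEdges z n u w ≡ true →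
                    ∃[ k ] k < n × sameEdge (z k) (z (suc k)) u w ≡ true
  pathEdges-sound z n e with anyFin-sound _ e
  ... | r , se = toℕ r , Finₚ.toℕ<n r , se

  pathEdges-complete : (z : ℕ → V a b) (n : ℕ) {u w : V a b} (k : ℕ) → k < n →
                       sameEdge (z k) (z (suc k)) u w ≡ true → pathEdges z n u w ≡ true
  pathEdges-complete z n {u} {w} k k<n se =
    anyFin-complete (λ r → sameEdge (z (toℕ r)) (z (suc (toℕ r))) u w) (fromℕ< k<n)
      (subst (λ j → sameEdge (z j) (z (suc j)) u w ≡ true) (sym (Finₚ.toℕ-fromℕ< k<n)) se)

  pathEdges-sym : (z : ℕ → V a b) (n : ℕ) (u w : V a b) → pathEdges z n u w ≡ pathEdges z n w u
  pathEdges-sym z n = pairEdges-sym {n = n} (λ r → z (toℕ r)) (λ r → z (suc (toℕ r)))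

  private
    reversed-edge : (z : ℕ → V a b) {n k : ℕ} (u w : V a b) → k < n →
      sameEdge (z (n ∸ k)) (z (n ∸ suc k)) u w ≡ sameEdge (z (n ∸ suc k)) (z (suc (n ∸ suc k))) u w
    reversed-edge z {n} {k} u w k<n =
      trans (cong (λ i → sameEdge (z i) (z (n ∸ suc k)) u w) (+-∸-assoc 1 k<n))
            (sameEdge-symˡ (z (suc (n ∸ suc k))) _ u w)

    reverse⇒ : (z : ℕ → V a b) (n : ℕ) {u w : V a b} →
               pathEdges (λ i → z (n ∸ i)) n u w ≡ true → pathEdges z n u w ≡ true
    reverse⇒ z n {u} {w} e with pathEdges-sound (λ i → z (n ∸ i)) n e
    ... | k , k<n , se = pathEdges-complete z n (n ∸ suc k) (∸-monoʳ-< {n} (s≤s z≤n) k<n)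
                           (trans (sym (reversed-edge z u w k<n)) se)

  pathEdges-reverse : (z : ℕ → V a b) (n : ℕ) (u w : V a b) →
                      pathEdges (λ i → z (n ∸ i)) n u w ≡ pathEdges z n u w
  pathEdges-reverse z n u w = Bool-ext (reverse⇒ z n) reverse⇐
    where
    reverse⇐ : pathEdges z n u w ≡ true → pathEdges (λ i → z (n ∸ i)) n u w ≡ true
    reverse⇐ e with pathEdges-sound z n e
    ... | k , k<n , se = pathEdges-complete (λ i → z (n ∸ i)) n k' k'<n
                           (trans (reversed-edge z u w k'<n)
                                  (subst (λ i → sameEdge (z i) (z (suc i)) u w ≡ true) (sym k'-back) se))
      where
      k' = n ∸ suc k
      k'<n = ∸-monoʳ-< {n} (s≤s z≤n) k<n
      k'-back : n ∸ suc k' ≡ k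
      k'-back = trans (cong (n ∸_) (sym (+-∸-assoc 1 k<n))) (m∸[m∸n]≡n (<⇒≤ k<n))

  pathEdges-uncons : (z : ℕ → V a b) (n : ℕ) → 0 < n → ∀ u w →
    pathEdges z n u w ≡ (sameEdge (z 0) (z 1) u w ∨ pathEdges (λ k → z (suc k)) (n ∸ 1) u w)
  pathEdges-uncons z (suc n) _ u w = refl

  path-distinct : (z : ℕ → V a b) (n : ℕ) → IsPath z n →
                  DistinctPairs {n = n} (λ r → z (toℕ r)) (λ r → z (suc (toℕ r)))
  path-distinct z n path = (λ r r' e → Finₚ.toℕ-injective (path _ _ (below r) (below r') e)) , no-flip
    where
    below : (r : Fin n) → toℕ r ≤ n
    below r = <⇒≤ (Finₚ.toℕ<n r)
    no-flip : ∀ r r' → z (toℕ r) ≡ z (suc (toℕ r')) → z (suc (toℕ r)) ≡ z (toℕ r') → ⊥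
    no-flip r r' e₁ e₂ = m≢2+m (trans (sym (path _ _ (Finₚ.toℕ<n r) (below r') e₂))
                                      (cong suc (path _ _ (below r) (Finₚ.toℕ<n r') e₁)))
      where
      m≢2+m : ∀ {m} → m ≢ suc (suc m)
      m≢2+m ()

  pathDegree : (ℕ → V a b) → ℕ → V a b → ℕ
  pathDegree z n u = sumV (λ w → ⟦ crossᵇ u w ∧ pathEdges z n u w ⟧)

  -- IsPath only asks for distinct vertices, so consecutive vertices of z in the same part of
  -- K_{a,b} are not joined by an edge; edge? z n k says whether the k-th step is an edge.
  edge? : (ℕ → V a b) → ℕ → ℕ → Bool
  edge? z n k = (k <ᵇ n) ∧ crossᵇ (z k) (z (suc k))

  edgeBefore? : (ℕ → V a b) → ℕ → ℕ → Bool
  edgeBefore? z n zero    = false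
  edgeBefore? z n (suc k) = edge? z n k

  module _ (z : ℕ → V a b) (n : ℕ) (path : IsPath z n) where

    private
      real : ℕ → ℕ
      real k = ⟦ crossᵇ (z k) (z (suc k)) ⟧

      weight-elsewhere : ∀ k {u} → z k ≢ u → real k * ⟦ z k ==V u ⟧ ≡ 0
      weight-elsewhere k ne = trans (cong (real k *_) (cong ⟦_⟧ (==V-≢ ne))) (*-zeroʳ (real k))

      outgoing : ∀ j → j ≤ n → sum {n} (λ r → real (toℕ r) * ⟦ z (toℕ r) ==V z j ⟧) ≡ ⟦ edge? z n j ⟧
      outgoing j j≤n with m≤n⇒m<n∨m≡n j≤n
      ... | inj₁ j<n =
        trans (sum-toℕ-δ (λ k → real k * ⟦ z k ==V z j ⟧) j<n
                         (λ k k<n k≢j → weight-elsewhere k (k≢j ∘ path k j (<⇒≤ k<n) j≤n)))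
              (trans (cong (λ x → real j * ⟦ x ⟧) (==V-refl (z j)))
                     (trans (*-identityʳ (real j))
                            (cong (λ x → ⟦ x ∧ crossᵇ (z j) (z (suc j)) ⟧) (sym (<ᵇ-true j<n)))))
      ... | inj₂ refl =
        trans (sum-toℕ-zero (λ k → real k * ⟦ z k ==V z j ⟧)
                            (λ k k<n → weight-elsewhere k (<⇒≢ k<n ∘ path k j (<⇒≤ k<n) j≤n)))
              (cong (λ x → ⟦ x ∧ crossᵇ (z j) (z (suc j)) ⟧) (sym (<ᵇ-false {j} ≤-refl)))

      incoming : ∀ j → j ≤ n → sum {n} (λ r → real (toℕ r) * ⟦ z (suc (toℕ r)) ==V z j ⟧) ≡ ⟦ edgeBefore? z n j ⟧
      incoming zero _ =
        sum-toℕ-zero (λ k → real k * ⟦ z (suc k) ==V z 0 ⟧)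
                     (λ k k<n → trans (cong (λ x → real k * ⟦ x ⟧)
                                                 (==V-≢ (λ e → case path _ _ k<n z≤n e of λ ())))
                                      (*-zeroʳ (real k)))
      incoming (suc j) j<n =
        trans (sum-toℕ-δ (λ k → real k * ⟦ z (suc k) ==V z (suc j) ⟧) j<n
                         (λ k k<n k≢j → trans (cong (λ x → real k * ⟦ x ⟧)
                                                    (==V-≢ (k≢j ∘ suc-injective ∘ path _ _ k<n j<n)))
                                              (*-zeroʳ (real k))))
              (trans (cong (λ x → real j * ⟦ x ⟧) (==V-refl (z (suc j))))
                     (trans (*-identityʳ (real j))
                            (cong (λ x → ⟦ x ∧ crossᵇ (z j) (z (suc j)) ⟧) (sym (<ᵇ-true j<n)))))

    pathDegree-at : ∀ j → j ≤ n → pathDegree z n (z j) ≡ ⟦ edgeBefore? z n j ⟧ + ⟦ edge? z n j ⟧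
    pathDegree-at j j≤n = begin
      pathDegree z n (z j)
        ≡⟨ pairEdges-degree _ _ (path-distinct z n path) (z j) ⟩
      sum {n} (λ r → real (toℕ r) * (starts (toℕ r) + ends (toℕ r)))
        ≡⟨ sum-cong-≗ {n} (λ r → *-distribˡ-+ (real (toℕ r)) (starts (toℕ r)) (ends (toℕ r))) ⟩
      sum {n} (λ r → real (toℕ r) * starts (toℕ r) + real (toℕ r) * ends (toℕ r))
        ≡⟨ ∑-distrib-+ {n} (λ r → real (toℕ r) * starts (toℕ r)) (λ r → real (toℕ r) * ends (toℕ r)) ⟩
      sum {n} (λ r → real (toℕ r) * starts (toℕ r)) + sum {n} (λ r → real (toℕ r) * ends (toℕ r))
        ≡⟨ cong₂ _+_ (outgoing j j≤n) (incoming j j≤n) ⟩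
      ⟦ edge? z n j ⟧ + ⟦ edgeBefore? z n j ⟧
        ≡⟨ +-comm ⟦ edge? z n j ⟧ _ ⟩
      ⟦ edgeBefore? z n j ⟧ + ⟦ edge? z n j ⟧ ∎
      where
      open ≡-Reasoning
      starts ends : ℕ → ℕ
      starts k = ⟦ z k ==V z j ⟧
      ends k = ⟦ z (suc k) ==V z j ⟧

    pathDegree-off : ∀ u → (∀ k → k ≤ n → z k ≢ u) → pathDegree z n u ≡ 0
    pathDegree-off u off =
      trans (pairEdges-degree _ _ (path-distinct z n path) u)
            (sum-zero (λ r → trans (cong₂ (λ x y → real (toℕ r) * (⟦ x ⟧ + ⟦ y ⟧))
                                          (==V-≢ (off _ (<⇒≤ (Finₚ.toℕ<n r))))
                                          (==V-≢ (off _ (Finₚ.toℕ<n r))))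
                                   (*-zeroʳ (real (toℕ r)))))

    module _ (all-cross : ∀ k → k < n → crossᵇ (z k) (z (suc k)) ≡ true) where

      private
        before-full : ∀ j → j ≤ n → edgeBefore? z n j ≡ not (z 0 ==V z j)
        before-full zero    _   = cong not (sym (==V-refl (z 0)))
        before-full (suc j) j<n =
          trans (cong₂ _∧_ (<ᵇ-true j<n) (all-cross j j<n))
                (cong not (sym (==V-≢ (λ e → case path 0 (suc j) z≤n j<n e of λ ()))))

        edge-full : ∀ j → j ≤ n → edge? z n j ≡ not (z n ==V z j)
        edge-full j j≤n with m≤n⇒m<n∨m≡n j≤n
        ... | inj₁ j<n  = trans (cong₂ _∧_ (<ᵇ-true j<n) (all-cross j j<n))
                                (cong not (sym (==V-≢ (<⇒≢ j<n ∘ sym ∘ path n j ≤-refl j≤n))))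
        ... | inj₂ refl = trans (cong (_∧ crossᵇ (z j) (z (suc j))) (<ᵇ-false {j} ≤-refl))
                                (cong not (sym (==V-refl (z j))))

      pathDegree-full : ∀ j → j ≤ n → pathDegree z n (z j) ≡ ⟦ not (z 0 ==V z j) ⟧ + ⟦ not (z n ==V z j) ⟧
      pathDegree-full j j≤n = trans (pathDegree-at j j≤n)
        (cong₂ (λ p q → ⟦ p ⟧ + ⟦ q ⟧) (before-full j j≤n) (edge-full j j≤n))

      pathDegree-ends : z 0 ≢ z n → pathDegree z n (z 0) ≡ 1 × pathDegree z n (z n) ≡ 1
      pathDegree-ends z0≢zn =
        trans (pathDegree-full 0 z≤n)
              (cong₂ (λ p q → ⟦ not p ⟧ + ⟦ not q ⟧) (==V-refl (z 0)) (==V-≢ (z0≢zn ∘ sym))) ,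
        trans (pathDegree-full n ≤-refl) (cong₂ (λ p q → ⟦ not p ⟧ + ⟦ not q ⟧) (==V-≢ z0≢zn) (==V-refl (z n)))

      odd?-pathDegree : ∀ u → odd? (pathDegree z n u) ≡ ((z 0 ==V u) xor (z n ==V u))
      odd?-pathDegree u with Finₚ.any? {n = suc n} (λ r → z (toℕ r) ≟V u)
      ... | yes (r , refl) =
        trans (cong odd? (pathDegree-full j (s≤s⁻¹ (Finₚ.toℕ<n r))))
              (trans (odd?-⟦⟧+⟦⟧ (not (z 0 ==V z j)) _) (Boolₚ.xor-annihilates-not (z 0 ==V z j) _))
        where j = toℕ r
      ... | no off = trans (cong odd? (pathDegree-off u off′))
                           (sym (cong₂ _xor_ (==V-≢ (off′ 0 z≤n)) (==V-≢ (off′ n ≤-refl))))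
        where
        off′ : ∀ k → k ≤ n → z k ≢ u
        off′ k k≤n e = off (fromℕ< (s≤s k≤n) , trans (cong z (Finₚ.toℕ-fromℕ< (s≤s k≤n))) e)

      sum-pathDegree-left : sum {a} (λ i → pathDegree z n (inj₁ i)) ≡ n
      sum-pathDegree-left = begin
        sum (λ i → pathDegree z n (inj₁ i))
          ≡⟨ sum-cong-≗ (λ i → pairEdges-degree (λ r → z (toℕ r)) (λ r → z (suc (toℕ r)))
                                                (path-distinct z n path) (inj₁ i)) ⟩
        sum (λ i → sum {n} (λ r → real (toℕ r) * (at (toℕ r) i + at (suc (toℕ r)) i)))
          ≡⟨ ∑-comm {a} {n} (λ i r → real (toℕ r) * (at (toℕ r) i + at (suc (toℕ r)) i)) ⟩
        sum {n} (λ r → sum (λ i → real (toℕ r) * (at (toℕ r) i + at (suc (toℕ r)) i)))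
          ≡⟨ sum-cong-≗ (λ r → edge-has-one-left-end (toℕ r) (Finₚ.toℕ<n r)) ⟩
        sum {n} (λ _ → 1)
          ≡⟨ sum-ones n ⟩
        n ∎
        where
        open ≡-Reasoning
        at : ℕ → Fin a → ℕ
        at k i = ⟦ z k ==V inj₁ i ⟧
        edge-has-one-left-end : ∀ k → k < n → sum (λ i → real k * (at k i + at (suc k) i)) ≡ 1
        edge-has-one-left-end k k<n = begin
          sum (λ i → real k * (at k i + at (suc k) i))
            ≡⟨ sum-cong-≗ (λ i → trans (cong (λ e → ⟦ e ⟧ * (at k i + at (suc k) i)) (all-cross k k<n))
                                        (+-identityʳ _)) ⟩
          sum (λ i → at k i + at (suc k) i)
            ≡⟨ ∑-distrib-+ (at k) (at (suc k)) ⟩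
          sum (at k) + sum (at (suc k))
            ≡⟨ cong₂ _+_ (sum-left-indicator (z k)) (sum-left-indicator (z (suc k))) ⟩
          ⟦ isLeft (z k) ⟧ + ⟦ isLeft (z (suc k)) ⟧
            ≡⟨ ⟦⟧+⟦⟧-xor (isLeft (z k)) _ (all-cross k k<n) ⟩
          1 ∎

    start-neighbour : ∀ {w} → pathEdges z n (z 0) w ≡ true → w ≡ z 1
    start-neighbour {w} e with pathEdges-sound z n e
    ... | k , k<n , se with sameEdge-sound (z k) (z (suc k)) (z 0) w se
    ...   | inj₁ (zk≡z0 , zk+1≡w) = trans (sym zk+1≡w) (cong (λ i → z (suc i)) (path k 0 (<⇒≤ k<n) z≤n zk≡z0))
    ...   | inj₂ (_ , zk+1≡z0)    = case path (suc k) 0 k<n z≤n zk+1≡z0 of λ ()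

    end-neighbour : ∀ {w} → pathEdges z n (z n) w ≡ true → w ≡ z (n ∸ 1)
    end-neighbour {w} e with pathEdges-sound z n e
    ... | k , k<n , se with sameEdge-sound (z k) (z (suc k)) (z n) w se
    ...   | inj₁ (zk≡zn , _)       = ⊥-elim (<⇒≢ k<n (path k n (<⇒≤ k<n) ≤-refl zk≡zn))
    ...   | inj₂ (zk≡w , zk+1≡zn) =
      trans (sym zk≡w) (cong z (cong (_∸ 1) (path (suc k) n k<n ≤-refl zk+1≡zn)))

  first-edge-once : (z : ℕ → V a b) (n : ℕ) → IsPath z n → ∀ u w →
                    Disjointᵇ (sameEdge (z 0) (z 1) u w) (pathEdges (λ i → z (suc i)) (n ∸ 1) u w)
  first-edge-once z zero    path u w first ()
  first-edge-once z (suc n) path u w first later with pathEdges-sound (λ i → z (suc i)) n later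
  ... | k , k<n , se with sameEdge-unique _ _ _ _ u w first se
  ...   | inj₁ (z0≡ , _) = case path 0 (suc k) z≤n (s≤s (<⇒≤ k<n)) z0≡ of λ ()
  ...   | inj₂ (z0≡ , _) = case path 0 (suc (suc k)) z≤n (s≤s k<n) z0≡ of λ ()

  tail-path : (z : ℕ → V a b) (n : ℕ) → IsPath z (suc n) → IsPath (λ i → z (suc i)) n
  tail-path z n path i j i≤n j≤n e = suc-injective (path _ _ (s≤s i≤n) (s≤s j≤n) e)

  record PathFromTo (p q : V a b) : Set where
    field
      len        : ℕ
      z          : ℕ → V a b
      z-path     : IsPath z len
      z-start    : z 0 ≡ p
      z-end      : z len ≡ q
      z-cross    : ∀ k → k < len → crossᵇ (z k) (z (suc k)) ≡ true

  reverse-PathFromTo : {p q : V a b} → PathFromTo p q → PathFromTo q p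
  reverse-PathFromTo {p} {q} Z = record
    { len     = n
    ; z       = λ i → z (n ∸ i)
    ; z-path  = λ i j i≤n j≤n e → ∸-cancelˡ-≡ i≤n j≤n (z-path _ _ (m∸n≤m n i) (m∸n≤m n j) e)
    ; z-start = z-end
    ; z-end   = trans (cong z (n∸n≡0 n)) z-start
    ; z-cross = λ k k<n → trans (cong (λ i → crossᵇ (z i) (z (n ∸ suc k))) (+-∸-assoc 1 k<n))
                                (trans (crossᵇ-sym (z (suc (n ∸ suc k))) _)
                                       (z-cross (n ∸ suc k) (∸-monoʳ-< {n} (s≤s z≤n) k<n)))
    }
    where open PathFromTo Z renaming (len to n)

  isLeft-along : (z : ℕ → V a b) (n : ℕ) → (∀ k → k < n → crossᵇ (z k) (z (suc k)) ≡ true) →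
                 ∀ k → k ≤ n → isLeft (z k) ≡ (isLeft (z 0) xor odd? k)
  isLeft-along z n all-cross zero    _   = sym (Boolₚ.xor-identityʳ (isLeft (z 0)))
  isLeft-along z n all-cross (suc k) k<n = begin
    isLeft (z (suc k))
      ≡⟨ xor-solve (isLeft (z k)) (all-cross k k<n) ⟩
    isLeft (z k) xor true
      ≡⟨ Boolₚ.xor-comm (isLeft (z k)) true ⟩
    not (isLeft (z k))
      ≡⟨ cong not (isLeft-along z n all-cross k (<⇒≤ k<n)) ⟩
    not (isLeft (z 0) xor odd? k)
      ≡⟨ Boolₚ.not-distribʳ-xor (isLeft (z 0)) (odd? k) ⟩
    isLeft (z 0) xor odd? (suc k) ∎
    where open ≡-Reasoning

  even-path-same-side : (z : ℕ → V a b) (n : ℕ) → Even n → (∀ k → k < n → crossᵇ (z k) (z (suc k)) ≡ true) →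
                        ∀ w → crossᵇ (z 0) w ≡ crossᵇ (z n) w
  even-path-same-side z n even-n all-cross w =
    cong (_xor isLeft w) (sym (trans (isLeft-along z n all-cross n ≤-refl)
                                     (trans (cong (isLeft (z 0) xor_) (Even⇒¬odd? even-n))
                                            (Boolₚ.xor-identityʳ (isLeft (z 0))))))

  three≤length : {L : EdgeSet a b} (w : ℕ → V a b) (n : ℕ) → PathIn L w n →
              w 0 ≢ w n → w 1 ≢ w n → adjV L (w n) (w 1) ≡ false → 3 ≤ n
  three≤length w zero _ w0≢wn _ _ = ⊥-elim (w0≢wn refl)
  three≤length w (suc zero) _ _ w1≢wn _ = ⊥-elim (w1≢wn refl)
  three≤length {L} w (suc (suc zero)) w-in-L _ _ no-edge =
    case trans (sym no-edge) (trans (adjV-sym L (w 2) (w 1)) (w-in-L 1 ≤-refl)) of λ ()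
  three≤length w (suc (suc (suc n))) _ _ _ _ = s≤s (s≤s (s≤s z≤n))

  closePath : (g : ℕ → V a b) (n : ℕ) → 2 ≤ n → IsPath g n →
              (∀ k → k < n → crossᵇ (g k) (g (suc k)) ≡ true) → crossᵇ (g n) (g 0) ≡ true → Cycle a b (suc n)
  closePath g n 2≤n path g-cross closing = record
    { vtx   = λ r → g (toℕ r)
    ; inj   = λ {r} {r'} e → Finₚ.toℕ-injective (path _ _ (s≤s⁻¹ (Finₚ.toℕ<n r)) (s≤s⁻¹ (Finₚ.toℕ<n r')) e)
    ; three = s≤s 2≤n
    ; cross = λ r → crossᵇ⇒Cross _ _ (cycle-cross r)
    }
    where
    cycle-cross : ∀ r → crossᵇ (g (toℕ r)) (g (toℕ (next (suc n) r))) ≡ true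
    cycle-cross r with m≤n⇒m<n∨m≡n (s≤s⁻¹ (Finₚ.toℕ<n r))
    ... | inj₁ r<n = subst (λ k → crossᵇ (g (toℕ r)) (g k) ≡ true) (sym (toℕ-next-< r r<n)) (g-cross _ r<n)
    ... | inj₂ r≡n = subst₂ (λ k k' → crossᵇ (g k) (g k') ≡ true) (sym r≡n) (sym (toℕ-next-≡ r r≡n)) closing

  closePath-edges : (g : ℕ → V a b) (n : ℕ) (2≤n : 2 ≤ n) (path : IsPath g n)
    (g-cross : ∀ k → k < n → crossᵇ (g k) (g (suc k)) ≡ true) (closing : crossᵇ (g n) (g 0) ≡ true) →
    ∀ i j → cycEdges (closePath g n 2≤n path g-cross closing) i j ≡
            (pathEdges g n (inj₁ i) (inj₂ j) ∨ sameEdge (g n) (g 0) (inj₁ i) (inj₂ j))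
  closePath-edges g n _ _ _ _ i j =
    trans (anyFin-init-last (λ r → sameEdge (g (toℕ r)) (g (toℕ (next (suc n) r))) (inj₁ i) (inj₂ j)))
          (cong₂ _∨_ (anyFin-cong {n} (λ k → cong₂ (λ p q → sameEdge (g p) (g q) (inj₁ i) (inj₂ j))
                                                (Finₚ.toℕ-inject₁ k) (cong toℕ (next-inject₁ k))))
                     (cong₂ (λ p q → sameEdge (g p) (g q) (inj₁ i) (inj₂ j))
                            (Finₚ.toℕ-fromℕ n) (cong toℕ (next-fromℕ n))))

  closeTail : (g : ℕ → V a b) (n : ℕ) → 3 ≤ n → IsPath g n →
              (∀ k → k < n → crossᵇ (g k) (g (suc k)) ≡ true) → crossᵇ (g n) (g 1) ≡ true → Cycle a b n
  closeTail g (suc n) (s≤s 2≤n) path g-cross closing =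
    closePath (λ i → g (suc i)) n 2≤n (tail-path g n path) (λ k k<n → g-cross (suc k) (s≤s k<n)) closing

  closeTail-edges : (g : ℕ → V a b) (n : ℕ) (3≤n : 3 ≤ n) (path : IsPath g n)
    (g-cross : ∀ k → k < n → crossᵇ (g k) (g (suc k)) ≡ true) (closing : crossᵇ (g n) (g 1) ≡ true) →
    ∀ i j → cycEdges (closeTail g n 3≤n path g-cross closing) i j ≡
            (pathEdges (λ k → g (suc k)) (n ∸ 1) (inj₁ i) (inj₂ j) ∨ sameEdge (g n) (g 1) (inj₁ i) (inj₂ j))
  closeTail-edges g (suc n) (s≤s 2≤n) path g-cross closing =
    closePath-edges (λ i → g (suc i)) n 2≤n (tail-path g n path) (λ k k<n → g-cross (suc k) (s≤s k<n)) closing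


-- Two edge-disjoint paths

module _ {a b : ℕ} where

  PathUnion : EdgeSet a b → (ℕ → V a b) → ℕ → (ℕ → V a b) → ℕ → Set
  PathUnion L x t y s = ∀ i j →
    (L i j ≡ (pathEdges x t (inj₁ i) (inj₂ j) ∨ pathEdges y s (inj₁ i) (inj₂ j))) ×
    Disjointᵇ (pathEdges x t (inj₁ i) (inj₂ j)) (pathEdges y s (inj₁ i) (inj₂ j))

  deg-PathUnion : (L : EdgeSet a b) (x : ℕ → V a b) (t : ℕ) (y : ℕ → V a b) (s : ℕ) →
                  PathUnion L x t y s → ∀ u → deg L u ≡ pathDegree x t u + pathDegree y s u
  deg-PathUnion L x t y s union u =
    trans (deg≡sumV L u)
          (trans (sumV-cong (pointwise u))
                 (sumV-+ (λ w → ⟦ crossᵇ u w ∧ pathEdges x t u w ⟧) (λ w → ⟦ crossᵇ u w ∧ pathEdges y s u w ⟧)))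
    where
    pointwise : ∀ u w → ⟦ adjV L u w ⟧ ≡ ⟦ crossᵇ u w ∧ pathEdges x t u w ⟧ + ⟦ crossᵇ u w ∧ pathEdges y s u w ⟧
    pointwise (inj₁ _) (inj₁ _) = refl
    pointwise (inj₂ _) (inj₂ _) = refl
    pointwise (inj₁ i) (inj₂ j) =
      trans (cong ⟦_⟧ (proj₁ (union i j))) (⟦∨⟧ (pathEdges x t (inj₁ i) (inj₂ j)) _ (proj₂ (union i j)))
    pointwise (inj₂ j) (inj₁ i) =
      trans (cong ⟦_⟧ (proj₁ (union i j)))
            (trans (⟦∨⟧ (pathEdges x t (inj₁ i) (inj₂ j)) _ (proj₂ (union i j)))
                   (cong₂ (λ p q → ⟦ p ⟧ + ⟦ q ⟧) (pathEdges-sym x t (inj₁ i) (inj₂ j))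
                                                   (pathEdges-sym y s (inj₁ i) (inj₂ j))))

  adjV-PathUnion : {L : EdgeSet a b} {x y : ℕ → V a b} {t s : ℕ} → PathUnion L x t y s →
    ∀ u w → adjV L u w ≡ (crossᵇ u w ∧ (pathEdges x t u w ∨ pathEdges y s u w))
  adjV-PathUnion {L} {x} {y} {t} {s} union =
    adjV≡crossᵇ∧ L _ (λ u w → cong₂ _∨_ (pathEdges-sym x t u w) (pathEdges-sym y s u w))
                     (λ i j → proj₁ (union i j))

  size-PathUnion : {L : EdgeSet a b} {x y : ℕ → V a b} {t s : ℕ} → IsPath x t → IsPath y s →
    (∀ k → k < t → crossᵇ (x k) (x (suc k)) ≡ true) → (∀ k → k < s → crossᵇ (y k) (y (suc k)) ≡ true) →
    PathUnion L x t y s → size L ≡ t + s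
  size-PathUnion {L} {x} {y} {t} {s} x-path y-path x-cross y-cross union = begin
    size L
      ≡⟨ size≡sum L ⟩
    sum (λ i → deg L (inj₁ i))
      ≡⟨ sum-cong-≗ (λ i → deg-PathUnion L x t y s union (inj₁ i)) ⟩
    sum (λ i → pathDegree x t (inj₁ i) + pathDegree y s (inj₁ i))
      ≡⟨ ∑-distrib-+ (λ i → pathDegree x t (inj₁ i)) (λ i → pathDegree y s (inj₁ i)) ⟩
    sum (λ i → pathDegree x t (inj₁ i)) + sum (λ i → pathDegree y s (inj₁ i))
      ≡⟨ cong₂ _+_ (sum-pathDegree-left x t x-path x-cross) (sum-pathDegree-left y s y-path y-cross) ⟩
    t + s ∎
    where
    open ≡-Reasoning
    size≡sum : ∀ {n} (E : EdgeSet n b) → size E ≡ sum (λ i → count (λ j → E i j))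
    size≡sum {zero}  E = refl
    size≡sum {suc n} E = cong (count (λ j → E fz j) +_) (size≡sum (λ i → E (fs i)))

  PathUnion-cong : (L : EdgeSet a b) (x : ℕ → V a b) (t : ℕ) (y : ℕ → V a b) (s : ℕ) (z : ℕ → V a b) (n : ℕ) →
    PathUnion L x t y s → (∀ u w → (crossᵇ u w ∧ pathEdges y s u w) ≡ (crossᵇ u w ∧ pathEdges z n u w)) →
    PathUnion L x t z n
  PathUnion-cong L x t y s z n union same i j =
    trans (proj₁ (union i j)) (cong (pathEdges x t (inj₁ i) (inj₂ j) ∨_) (same (inj₁ i) (inj₂ j))) ,
    λ eX eZ → proj₂ (union i j) eX (trans (same (inj₁ i) (inj₂ j)) eZ)

  PathUnion-second-in : {L : EdgeSet a b} {x y : ℕ → V a b} {t s : ℕ} → PathUnion L x t y s →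
    (∀ k → k < s → crossᵇ (y k) (y (suc k)) ≡ true) → PathIn L y s
  PathUnion-second-in {L} {x} {y} {t} {s} union y-cross k k<s =
    trans (adjV-PathUnion {L = L} {x} {y} {t} {s} union (y k) (y (suc k)))
          (∧-true⁺ (y-cross k k<s)
                   (∨-introʳ (pathEdges x t (y k) (y (suc k)))
                             (pathEdges-complete y s k k<s (sameEdge-refl (y k) (y (suc k))))))

  EdgesFormPath : (ℕ → V a b) → ℕ → V a b → V a b → Set
  EdgesFormPath y s p q = Σ[ Z ∈ PathFromTo p q ]
    (∀ u w → (crossᵇ u w ∧ pathEdges y s u w) ≡ (crossᵇ u w ∧ pathEdges (PathFromTo.z Z) (PathFromTo.len Z) u w))

  module _ (y : ℕ → V a b) (s : ℕ) (path : IsPath y s) (p q : V a b)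
           (odd-ends : ∀ u → odd? (pathDegree y s u) ≡ ((p ==V u) xor (q ==V u)))
           {k₀ k₁ : ℕ} (k₀≤s : k₀ ≤ s) (y-k₀ : y k₀ ≡ p) (k₁≤s : k₁ ≤ s) (y-k₁ : y k₁ ≡ q) where

    private
      ==V-position : ∀ {k} → k ≤ s → ∀ {v} → y k ≡ v → ∀ j → j ≤ s → (v ==V y j) ≡ (j ≡ᵇ k)
      ==V-position k≤s refl j j≤s =
        Bool-ext (λ e → ≡ᵇ-≡ (sym (path _ _ k≤s j≤s (==V-sound e))))
                 (λ e → ==V-complete (cong y (sym (≡ᵇ-sound j _ e))))

      -- The parity of the degree at y j forces the edge after y j to be present exactly when
      -- the edge before it is present, unless y j is one of the two odd vertices p, q.
      before-char : ∀ j → j ≤ suc s → edgeBefore? y s j ≡ ((k₀ <ᵇ j) xor (k₁ <ᵇ j))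
      before-char zero    _     = refl
      before-char (suc j) j<s+1 = begin
        edge? y s j
          ≡⟨ xor-solve (edgeBefore? y s j)
               (trans (sym (odd?-⟦⟧+⟦⟧ (edgeBefore? y s j) _))
                      (trans (cong odd? (sym (pathDegree-at y s path j j≤s))) (odd-ends (y j)))) ⟩
        edgeBefore? y s j xor ((p ==V y j) xor (q ==V y j))
          ≡⟨ cong₂ (λ e o → e xor o) (before-char j (≤-trans j≤s (n≤1+n s)))
                   (cong₂ _xor_ (==V-position k₀≤s y-k₀ j j≤s) (==V-position k₁≤s y-k₁ j j≤s)) ⟩
        ((k₀ <ᵇ j) xor (k₁ <ᵇ j)) xor ((j ≡ᵇ k₀) xor (j ≡ᵇ k₁))
          ≡⟨ xor-interchange (k₀ <ᵇ j) (k₁ <ᵇ j) _ _ ⟩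
        ((k₀ <ᵇ j) xor (j ≡ᵇ k₀)) xor ((k₁ <ᵇ j) xor (j ≡ᵇ k₁))
          ≡⟨ sym (cong₂ _xor_ (<ᵇ-suc k₀ j) (<ᵇ-suc k₁ j)) ⟩
        (k₀ <ᵇ suc j) xor (k₁ <ᵇ suc j) ∎
        where
        open ≡-Reasoning
        j≤s = s≤s⁻¹ j<s+1

    cross-char : ∀ k → k < s → crossᵇ (y k) (y (suc k)) ≡ ((k₀ <ᵇ suc k) xor (k₁ <ᵇ suc k))
    cross-char k k<s =
      trans (cong (_∧ crossᵇ (y k) (y (suc k))) (sym (<ᵇ-true k<s))) (before-char (suc k) (s≤s (<⇒≤ k<s)))

    module _ (k₀<k₁ : k₀ < k₁) where

      private
        k₀≤k₁ : k₀ ≤ k₁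
        k₀≤k₁ = <⇒≤ k₀<k₁

        z : ℕ → V a b
        z i = y (i + k₀)

        shifted : ∀ {i} → i ≤ k₁ ∸ k₀ → i + k₀ ≤ k₁
        shifted i≤ = ≤-trans (+-monoˡ-≤ k₀ i≤) (≤-reflexive (m∸n+n≡m k₀≤k₁))

        in-y : ∀ {i} → i ≤ k₁ ∸ k₀ → i + k₀ ≤ s
        in-y i≤ = ≤-trans (shifted i≤) k₁≤s

        z-cross : ∀ i → i < k₁ ∸ k₀ → crossᵇ (z i) (z (suc i)) ≡ true
        z-cross i i< = trans (cross-char (i + k₀) (in-y i<))
                             (cong₂ _xor_ (<ᵇ-true (s≤s (m≤n+m k₀ i))) (<ᵇ-false (shifted i<)))

        cross-in-range : ∀ k → k < s → crossᵇ (y k) (y (suc k)) ≡ true → k₀ ≤ k × k < k₁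
        cross-in-range k k<s c with k₀ ≤? k | k₁ ≤? k
        ... | yes k₀≤k | no  k₁≰k = k₀≤k , ≰⇒> k₁≰k
        ... | yes k₀≤k | yes k₁≤k = case trans (sym c) (trans (cross-char k k<s)
                                       (cong₂ _xor_ (<ᵇ-true (s≤s k₀≤k)) (<ᵇ-true (s≤s k₁≤k)))) of λ ()
        ... | no  k₀≰k | _        = case trans (sym c) (trans (cross-char k k<s)
                                       (cong₂ _xor_ (<ᵇ-false (≰⇒> k₀≰k))
                                                    (<ᵇ-false (≤-trans (≰⇒> k₀≰k) k₀≤k₁)))) of λ ()

        y⇒z : ∀ u w → (crossᵇ u w ∧ pathEdges y s u w) ≡ true → (crossᵇ u w ∧ pathEdges z (k₁ ∸ k₀) u w) ≡ true
        y⇒z u w e with ∧-true⁻ (crossᵇ u w) e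
        ... | c , py with pathEdges-sound y s py
        ...   | k , k<s , se with cross-in-range k k<s (trans (sym (sameEdge-crossᵇ (y k) (y (suc k)) u w se)) c)
        ...     | k₀≤k , k<k₁ = ∧-true⁺ c (pathEdges-complete z (k₁ ∸ k₀) (k ∸ k₀) (∸-monoˡ-< k<k₁ k₀≤k)
                                  (subst (λ i → sameEdge (y i) (y (suc i)) u w ≡ true) (sym (m∸n+n≡m k₀≤k)) se))

        z⇒y : ∀ u w → (crossᵇ u w ∧ pathEdges z (k₁ ∸ k₀) u w) ≡ true → (crossᵇ u w ∧ pathEdges y s u w) ≡ true
        z⇒y u w e with ∧-true⁻ (crossᵇ u w) e
        ... | c , pz with pathEdges-sound z (k₁ ∸ k₀) pz
        ...   | i , i< , se = ∧-true⁺ c (pathEdges-complete y s (i + k₀) (in-y i<) se)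

      edges-between : EdgesFormPath y s p q
      edges-between =
        record { len     = k₁ ∸ k₀
               ; z       = z
               ; z-path  = λ i j i≤ j≤ e → +-cancelʳ-≡ k₀ i j (path _ _ (in-y i≤) (in-y j≤) e)
               ; z-start = y-k₀
               ; z-end   = trans (cong y (m∸n+n≡m k₀≤k₁)) y-k₁
               ; z-cross = z-cross
               } ,
        λ u w → Bool-ext (y⇒z u w) (z⇒y u w)

  private
    occurs-odd : (y : ℕ → V a b) (s : ℕ) → IsPath y s → ∀ v → odd? (pathDegree y s v) ≡ true →
                 ∃[ k ] k ≤ s × y k ≡ v
    occurs-odd y s path v odd-v with Finₚ.any? {n = suc s} (λ r → y (toℕ r) ≟V v)
    ... | yes (r , e) = toℕ r , s≤s⁻¹ (Finₚ.toℕ<n r) , e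
    ... | no off = case trans (sym odd-v) (cong odd? (pathDegree-off y s path v off′)) of λ ()
      where
      off′ : ∀ k → k ≤ s → y k ≢ v
      off′ k k≤s e = off (fromℕ< (s≤s k≤s) , trans (cong y (Finₚ.toℕ-fromℕ< (s≤s k≤s))) e)

  odd-ends⇒EdgesFormPath : (y : ℕ → V a b) (s : ℕ) → IsPath y s → (p q : V a b) → p ≢ q →
    (∀ u → odd? (pathDegree y s u) ≡ ((p ==V u) xor (q ==V u))) → EdgesFormPath y s p q
  odd-ends⇒EdgesFormPath y s path p q p≢q odd-ends
    with occurs-odd y s path p (trans (odd-ends p) (cong₂ _xor_ (==V-refl p) (==V-≢ (p≢q ∘ sym))))
       | occurs-odd y s path q (trans (odd-ends q) (cong₂ _xor_ (==V-≢ p≢q) (==V-refl q)))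
  ... | k₀ , k₀≤s , y-k₀ | k₁ , k₁≤s , y-k₁ with <-cmp k₀ k₁
  ...   | tri< k₀<k₁ _ _ = edges-between y s path p q odd-ends k₀≤s y-k₀ k₁≤s y-k₁ k₀<k₁
  ...   | tri≈ _ refl _  = ⊥-elim (p≢q (trans (sym y-k₀) y-k₁))
  ...   | tri> _ _ k₁<k₀ =
    proj₁ F , λ u w → trans (cong (crossᵇ u w ∧_) (sym (pathEdges-reverse y s u w))) (proj₂ F u w)
    where
    y′ : ℕ → V a b
    y′ i = y (s ∸ i)
    F = edges-between y′ s (λ i j i≤s j≤s e → ∸-cancelˡ-≡ i≤s j≤s (path _ _ (m∸n≤m s i) (m∸n≤m s j) e))
                      p q (λ u → trans (cong odd? (sumV-cong (λ w → cong (λ e → ⟦ crossᵇ u w ∧ e ⟧)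
                                                                         (pathEdges-reverse y s u w))))
                                       (odd-ends u))
                      (m∸n≤m s k₀) (trans (cong y (m∸[m∸n]≡n k₀≤s)) y-k₀)
                      (m∸n≤m s k₁) (trans (cong y (m∸[m∸n]≡n k₁≤s)) y-k₁)
                      (∸-monoʳ-< k₁<k₀ k₀≤s)

  rest-PathUnion : (L : EdgeSet a b) (x : ℕ → V a b) (t : ℕ) → PathIn L x t → (rest : RestIsPath L x t) →
                   PathUnion L x t (proj₁ (proj₂ rest)) (proj₁ rest)
  rest-PathUnion L x t x-in-L (s , y , _ , split) i j = Bool-ext L⇒ ⇒L , disjoint
    where
    X = pathEdges x t (inj₁ i) (inj₂ j)
    Y = pathEdges y s (inj₁ i) (inj₂ j)
    y-edge : PathEdge y s (inj₁ i) (inj₂ j) → Y ≡ true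
    y-edge (k , k<s , se) = pathEdges-complete y s k k<s se
    L⇒ : L i j ≡ true → (X ∨ Y) ≡ true
    L⇒ e with X in eX
    ... | true  = refl
    ... | false = y-edge (proj₁ (split i j) (e , λ (k , k<t , se) →
                    case trans (sym eX) (pathEdges-complete x t k k<t se) of λ ()))
    ⇒L : (X ∨ Y) ≡ true → L i j ≡ true
    ⇒L e with ∨-true⁻ X e
    ... | inj₁ eX = let k , k<t , se = pathEdges-sound x t eX in
                    trans (adjV-sameEdge L (x k) (x (suc k)) i j se) (x-in-L k k<t)
    ... | inj₂ eY = proj₁ (proj₂ (split i j) (pathEdges-sound y s eY))
    disjoint : Disjointᵇ X Y
    disjoint eX eY = proj₂ (proj₂ (split i j) (pathEdges-sound y s eY)) (pathEdges-sound x t eX)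

module _ {M : List ℕ} {a b : ℕ} where

  leave-closing-path : (Even a × Even b) ⊎ a ≡ b → (P : Packing M a b) (x : ℕ → V a b) (t : ℕ) →
    IsPath x t → 0 < t → PathIn (leave P) x t → RestIsPath (leave P) x t →
    Σ[ Z ∈ PathFromTo (x 0) (x t) ] PathUnion (leave P) x t (PathFromTo.z Z) (PathFromTo.len Z)
  leave-closing-path hab P x t x-path 0<t x-in-L rest@(s , y , y-path , _) =
    Z , PathUnion-cong (leave P) x t y s (PathFromTo.z Z) (PathFromTo.len Z) union same
    where
    union = rest-PathUnion (leave P) x t x-in-L rest
    x-cross : ∀ k → k < t → crossᵇ (x k) (x (suc k)) ≡ true
    x-cross k k<t = adjV⇒crossᵇ (leave P) (x k) (x (suc k)) (x-in-L k k<t)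
    odd-ends : ∀ u → odd? (pathDegree y s u) ≡ ((x 0 ==V u) xor (x t ==V u))
    odd-ends u = trans (xor-solve ((x 0 ==V u) xor (x t ==V u)) (begin
        ((x 0 ==V u) xor (x t ==V u)) xor odd? (pathDegree y s u)
          ≡⟨ cong (_xor odd? (pathDegree y s u)) (odd?-pathDegree x t x-path x-cross u) ⟨
        odd? (pathDegree x t u) xor odd? (pathDegree y s u)
          ≡⟨ odd?-+ (pathDegree x t u) _ ⟨
        odd? (pathDegree x t u + pathDegree y s u)
          ≡⟨ cong odd? (deg-PathUnion (leave P) x t y s union u) ⟨
        odd? (deg (leave P) u)
          ≡⟨ leave-degree-even P hab u ⟩
        false ∎))
      (Boolₚ.xor-identityʳ _)
      where open ≡-Reasoning
    x0≢xt : x 0 ≢ x t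
    x0≢xt e = <⇒≢ 0<t (x-path 0 t z≤n ≤-refl e)
    Z = proj₁ (odd-ends⇒EdgesFormPath y s y-path (x 0) (x t) x0≢xt odd-ends)
    same = proj₂ (odd-ends⇒EdgesFormPath y s y-path (x 0) (x t) x0≢xt odd-ends)


-- Switches

module _ {a b : ℕ} where

  switchEdges : (α β u v : V a b) → V a b → V a b → Bool
  switchEdges α β u v w w' =
    sameEdge α u w w' ∨ sameEdge α v w w' ∨ sameEdge β u w w' ∨ sameEdge β v w w'

  adjV-switched : {L L' : EdgeSet a b} {α β u v : V a b} → SwitchedLeave L L' α β u v →
    ∀ w w' → adjV L' w w' ≡ (adjV L w w' xor (crossᵇ w w' ∧ switchEdges α β u v w w'))
  adjV-switched sw (inj₁ _) (inj₁ _) = refl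
  adjV-switched sw (inj₂ _) (inj₂ _) = refl
  adjV-switched sw (inj₁ i) (inj₂ j) = sw i j
  adjV-switched {L} {α = α} {β} {u} {v} sw (inj₂ j) (inj₁ i) =
    trans (sw i j) (cong (L i j xor_) (cong₂ _∨_ (sameEdge-symʳ α u _ _) (cong₂ _∨_ (sameEdge-symʳ α v _ _)
                                        (cong₂ _∨_ (sameEdge-symʳ β u _ _) (sameEdge-symʳ β v _ _)))))

  private
    sameEdge-away : (p q w w' : V a b) → p ≢ w → sameEdge p q w w' ≡ ((p ==V w') ∧ (q ==V w))
    sameEdge-away p q w w' p≢w = cong (λ c → (c ∧ (q ==V w')) ∨ ((p ==V w') ∧ (q ==V w))) (==V-≢ p≢w)

  switchEdges-away : (α β u v w w' : V a b) → α ≢ w → β ≢ w →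
    switchEdges α β u v w w' ≡ (((α ==V w') ∨ (β ==V w')) ∧ ((u ==V w) ∨ (v ==V w)))
  switchEdges-away α β u v w w' α≢w β≢w = begin
    switchEdges α β u v w w'
      ≡⟨ cong₂ _∨_ (sameEdge-away α u w w' α≢w) (cong₂ _∨_ (sameEdge-away α v w w' α≢w)
           (cong₂ _∨_ (sameEdge-away β u w w' β≢w) (sameEdge-away β v w w' β≢w))) ⟩
    (A ∧ U) ∨ ((A ∧ W) ∨ ((B ∧ U) ∨ (B ∧ W)))
      ≡⟨ solve 4 (λ A B U W → (A :* U) :+ ((A :* W) :+ ((B :* U) :+ (B :* W))) := (A :+ B) :* (U :+ W))
               refl A B U W ⟩
    (A ∨ B) ∧ (U ∨ W) ∎
    where
    open ≡-Reasoning
    open ∨-∧-Solver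
    A = α ==V w'
    B = β ==V w'
    U = u ==V w
    W = v ==V w

  switchEdges-oriented : (α β u v p q : V a b) → (p ≡ α × q ≡ β) ⊎ (p ≡ β × q ≡ α) → ∀ w w' →
    ((sameEdge α u w w' ∨ sameEdge p v w w') ∨ (sameEdge β u w w' ∨ sameEdge q v w w')) ≡ switchEdges α β u v w w'
  switchEdges-oriented α β u v .α .β (inj₁ (refl , refl)) w w' =
    solve 4 (λ A B C D → (A :+ B) :+ (C :+ D) := A :+ (B :+ (C :+ D))) refl
          (sameEdge α u w w') (sameEdge α v w w') (sameEdge β u w w') (sameEdge β v w w')
    where open ∨-∧-Solver
  switchEdges-oriented α β u v .β .α (inj₂ (refl , refl)) w w' =
    solve 4 (λ A D C B → (A :+ D) :+ (C :+ B) := A :+ (B :+ (C :+ D))) refl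
          (sameEdge α u w w') (sameEdge β v w w') (sameEdge β u w w') (sameEdge α v w w')
    where open ∨-∧-Solver

  inX-adjacent : {L : EdgeSet a b} (α β w : V a b) → inX L α β w ≡ true → (adjV L α w xor adjV L β w) ≡ true
  inX-adjacent {L} α β w w∈X = proj₁ (∧-true⁻ (adjV L α w xor adjV L β w) w∈X)

  inX-≢ : {L : EdgeSet a b} {α β w : V a b} → inX L α β w ≡ true → w ≢ α × w ≢ β
  inX-≢ {L} {α} {β} {w} w∈X with ∧-true⁻ (adjV L α w xor adjV L β w) w∈X
  ... | _ , rest with ∧-true⁻ (not (w ==V α)) rest
  ...   | ¬wα , ¬wβ = (λ e → case trans (sym ¬wα) (cong not (==V-complete e)) of λ ())
                    , (λ e → case trans (sym ¬wβ) (cong not (==V-complete e)) of λ ())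

  private
    inX-crossᵇ : {L : EdgeSet a b} (α β w : V a b) → (∀ w → crossᵇ α w ≡ crossᵇ β w) →
                 inX L α β w ≡ true → crossᵇ α w ≡ true × crossᵇ β w ≡ true
    inX-crossᵇ {L} α β w same-side w∈X with xor-true⁻ (adjV L α w) _ (inX-adjacent {L} α β w w∈X)
    ... | inj₁ αw = let c = adjV⇒crossᵇ L α w αw in c , trans (sym (same-side w)) c
    ... | inj₂ βw = let c = adjV⇒crossᵇ L β w βw in trans (same-side w) c , c

  module _ {L L' : EdgeSet a b} {α β u v : V a b} (sw : SwitchedLeave L L' α β u v)
           {w : V a b} (α≢w : α ≢ w) (β≢w : β ≢ w) where

    switch-keeps-neighbours : ((u ==V w) ∨ (v ==V w)) ≡ false → ∀ w' → adjV L' w w' ≡ adjV L w w'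
    switch-keeps-neighbours unmoved w' = begin
      adjV L' w w'
        ≡⟨ adjV-switched {L} {L'} {α} {β} {u} {v} sw w w' ⟩
      adjV L w w' xor (crossᵇ w w' ∧ switchEdges α β u v w w')
        ≡⟨ cong (λ e → adjV L w w' xor (crossᵇ w w' ∧ e))
                (trans (switchEdges-away α β u v w w' α≢w β≢w) (trans (cong (_ ∧_) unmoved) (Boolₚ.∧-zeroʳ _))) ⟩
      adjV L w w' xor (crossᵇ w w' ∧ false)
        ≡⟨ cong (adjV L w w' xor_) (Boolₚ.∧-zeroʳ (crossᵇ w w')) ⟩
      adjV L w w' xor false
        ≡⟨ Boolₚ.xor-identityʳ (adjV L w w') ⟩
      adjV L w w' ∎
      where open ≡-Reasoning

    switch-swaps-α-β : (∀ w → crossᵇ α w ≡ crossᵇ β w) → inX L α β w ≡ true → ((u ==V w) ∨ (v ==V w)) ≡ true →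
                       ∀ w' → adjV L' w w' ≡ (adjV L w w' xor ((α ==V w') ∨ (β ==V w')))
    switch-swaps-α-β same-side w∈X moved w' =
      trans (adjV-switched {L} {L'} {α} {β} {u} {v} sw w w')
            (cong (adjV L w w' xor_)
                  (trans (cong (crossᵇ w w' ∧_) (trans (switchEdges-away α β u v w w' α≢w β≢w)
                                                       (trans (cong (_ ∧_) moved) (Boolₚ.∧-identityʳ _))))
                         cross-α-β))
      where
      cross-α-β : (crossᵇ w w' ∧ ((α ==V w') ∨ (β ==V w'))) ≡ ((α ==V w') ∨ (β ==V w'))
      cross-α-β with (α ==V w') ∨ (β ==V w') in at
      ... | false = Boolₚ.∧-zeroʳ (crossᵇ w w')
      ... | true with ∨-true⁻ (α ==V w') at
      ...   | inj₁ αw' = trans (Boolₚ.∧-identityʳ _) (subst (λ w' → crossᵇ w w' ≡ true) (==V-sound αw')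
                           (trans (crossᵇ-sym w α) (proj₁ (inX-crossᵇ α β w same-side w∈X))))
      ...   | inj₂ βw' = trans (Boolₚ.∧-identityʳ _) (subst (λ w' → crossᵇ w w' ≡ true) (==V-sound βw')
                           (trans (crossᵇ-sym w β) (proj₂ (inX-crossᵇ α β w same-side w∈X))))

  -- A switch changes the neighbourhood of a vertex w ∉ {α, β} only if w is u or v, and then it
  -- exchanges the edge to one of α, β for the edge to the other.
  switch-preserves-degree : {L L' : EdgeSet a b} {α β u v : V a b} → SwitchedLeave L L' α β u v →
    α ≢ β → (∀ w → crossᵇ α w ≡ crossᵇ β w) → inX L α β u ≡ true → inX L α β v ≡ true →
    ∀ w → α ≢ w → β ≢ w → deg L' w ≡ deg L w
  switch-preserves-degree {L} {L'} {α} {β} {u} {v} sw α≢β same-side u∈X v∈X w α≢w β≢w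
    with (u ==V w) ∨ (v ==V w) in moved
  ... | false = trans (deg≡sumV L' w)
                      (trans (sumV-cong (λ w' → cong ⟦_⟧ (switch-keeps-neighbours {L} {L'} {α} {β} {u} {v}
                                                                                 sw α≢w β≢w moved w')))
                             (sym (deg≡sumV L w)))
  ... | true = begin
    deg L' w
      ≡⟨ deg≡sumV L' w ⟩
    sumV (λ w' → ⟦ adjV L' w w' ⟧)
      ≡⟨ sumV-cong (λ w' → cong ⟦_⟧ (switch-swaps-α-β {L} {L'} {α} {β} {u} {v}
                                                      sw α≢w β≢w same-side w∈X moved w')) ⟩
    sumV (λ w' → ⟦ adjV L w w' xor ((α ==V w') ∨ (β ==V w')) ⟧)
      ≡⟨ sumV-toggle (adjV L w) α≢β (trans (cong₂ _xor_ (adjV-sym L w α) (adjV-sym L w β))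
                                           (inX-adjacent α β w w∈X)) ⟩
    sumV (λ w' → ⟦ adjV L w w' ⟧)
      ≡⟨ deg≡sumV L w ⟨
    deg L w ∎
    where
    open ≡-Reasoning
    w∈X : inX L α β w ≡ true
    w∈X with ∨-true⁻ (u ==V w) moved
    ... | inj₁ uw = subst (λ w → inX L α β w ≡ true) (==V-sound uw) u∈X
    ... | inj₂ vw = subst (λ w → inX L α β w ≡ true) (==V-sound vw) v∈X

numDeg4-mono : ∀ {a b} {L L' : EdgeSet a b} → (∀ u → deg L u ≡ 4 → deg L' u ≡ 4) → numDeg4 L ≤ numDeg4 L'
numDeg4-mono {L = L} {L'} deg4 =
  +-mono-≤ (count-mono _ _ (λ i e → ≡ᵇ-≡ (deg4 (inj₁ i) (≡ᵇ-sound (deg L (inj₁ i)) 4 e))))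
           (count-mono _ _ (λ j e → ≡ᵇ-≡ (deg4 (inj₂ j) (≡ᵇ-sound (deg L (inj₂ j)) 4 e))))


-- The switched leave splits into two cycles

module _ {a b : ℕ} {L L' : EdgeSet a b} {x z : ℕ → V a b} {t s : ℕ}
  (3≤t : 3 ≤ t) (3≤s : 3 ≤ s) (x-path : IsPath x t) (z-path : IsPath z s)
  (x-cross : ∀ k → k < t → crossᵇ (x k) (x (suc k)) ≡ true)
  (z-cross : ∀ k → k < s → crossᵇ (z k) (z (suc k)) ≡ true)
  (union : PathUnion L x t z s)
  (ends : (z 0 ≡ x 0 × z s ≡ x t) ⊎ (z 0 ≡ x t × z s ≡ x 0))
  (same-side : ∀ w → crossᵇ (x 0) w ≡ crossᵇ (x t) w)
  (x-chord : adjV L (x t) (x 1) ≡ false)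
  (z-chord : adjV L (z s) (z 1) ≡ false)
  (z1≢x1 : z 1 ≢ x 1)
  (switched : ∀ i j → L' i j ≡ (L i j xor
     ((sameEdge (x 0) (x 1) (inj₁ i) (inj₂ j) ∨ sameEdge (z 0) (z 1) (inj₁ i) (inj₂ j)) ∨
      (sameEdge (x t) (x 1) (inj₁ i) (inj₂ j) ∨ sameEdge (z s) (z 1) (inj₁ i) (inj₂ j)))))
  where

  private
    0<t : 0 < t
    0<t = ≤-trans (s≤s z≤n) 3≤t

    0<s : 0 < s
    0<s = ≤-trans (s≤s z≤n) 3≤s

    z-same-side : ∀ w → crossᵇ (z s) w ≡ crossᵇ (z 0) w
    z-same-side w = same-side-of ends
      where
      same-side-of : (z 0 ≡ x 0 × z s ≡ x t) ⊎ (z 0 ≡ x t × z s ≡ x 0) → crossᵇ (z s) w ≡ crossᵇ (z 0) w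
      same-side-of (inj₁ (z0≡ , zs≡)) =
        subst₂ (λ p q → crossᵇ p w ≡ crossᵇ q w) (sym zs≡) (sym z0≡) (sym (same-side w))
      same-side-of (inj₂ (z0≡ , zs≡)) =
        subst₂ (λ p q → crossᵇ p w ≡ crossᵇ q w) (sym zs≡) (sym z0≡) (same-side w)

    x-closing : crossᵇ (x t) (x 1) ≡ true
    x-closing = trans (sym (same-side (x 1))) (x-cross 0 0<t)

    z-closing : crossᵇ (z s) (z 1) ≡ true
    z-closing = trans (z-same-side (z 1)) (z-cross 0 0<s)

    C₁ : Cycle a b t
    C₁ = closeTail x t 3≤t x-path x-cross x-closing

    C₂ : Cycle a b s
    C₂ = closeTail z s 3≤s z-path z-cross z-closing

    x1∉ends : ∀ {p} → (p ≡ x 0 ⊎ p ≡ x t) → x 1 ≢ p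
    x1∉ends (inj₁ refl) e = case x-path 1 0 0<t z≤n e of λ ()
    x1∉ends (inj₂ refl) e = <⇒≢ (≤-trans (s≤s (s≤s z≤n)) 3≤t) (x-path 1 t 0<t ≤-refl e)

    zs-end : z s ≡ x 0 ⊎ z s ≡ x t
    zs-end = Data.Sum.map proj₂ proj₂ (Data.Sum.swap ends)

  module _ (i : Fin a) (j : Fin b) where
    private
      U W : V a b
      U = inj₁ i
      W = inj₂ j
      a₀ p b₀ q c d : Bool
      a₀ = sameEdge (x 0) (x 1) U W
      p  = pathEdges (λ k → x (suc k)) (t ∸ 1) U W
      b₀ = sameEdge (z 0) (z 1) U W
      q  = pathEdges (λ k → z (suc k)) (s ∸ 1) U W
      c  = sameEdge (x t) (x 1) U W
      d  = sameEdge (z s) (z 1) U W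

      x-edges : pathEdges x t U W ≡ (a₀ ∨ p)
      x-edges = pathEdges-uncons x t 0<t U W

      z-edges : pathEdges z s U W ≡ (b₀ ∨ q)
      z-edges = pathEdges-uncons z s 0<s U W

      L≡ : L i j ≡ ((a₀ ∨ p) ∨ (b₀ ∨ q))
      L≡ = trans (proj₁ (union i j)) (cong₂ _∨_ x-edges z-edges)

      x-z-disjoint : Disjointᵇ (a₀ ∨ p) (b₀ ∨ q)
      x-z-disjoint e₁ e₂ = proj₂ (union i j) (trans x-edges e₁) (trans z-edges e₂)

      chord-outside : ∀ {r s} → adjV L r s ≡ false → Disjointᵇ (sameEdge r s U W) (L i j)
      chord-outside {r} {s} no-edge e l = case trans (sym l) (trans (adjV-sameEdge L r s i j e) no-edge) of λ ()

      c∉L : Disjointᵇ c (L i j)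
      c∉L = chord-outside {x t} {x 1} x-chord

      d∉L : Disjointᵇ d (L i j)
      d∉L = chord-outside {z s} {z 1} z-chord

      chords-distinct : Disjointᵇ c d
      chords-distinct ec ed with sameEdge-unique (x t) (x 1) (z s) (z 1) U W ec ed
      ... | inj₁ (_ , x1≡z1) = z1≢x1 (sym x1≡z1)
      ... | inj₂ (_ , x1≡zs) = x1∉ends zs-end x1≡zs

      p∨q-vs-a∨b : Disjointᵇ (p ∨ q) (a₀ ∨ b₀)
      p∨q-vs-a∨b =
        Disjointᵇ-∨ˡ (Disjointᵇ-∨ʳ (λ ep ea → first-edge-once x t x-path U W ea ep)
                                  (λ ep eb → x-z-disjoint (∨-introʳ a₀ ep) (∨-introˡ q eb)))
                     (Disjointᵇ-∨ʳ (λ eq ea → x-z-disjoint (∨-introˡ p ea) (∨-introʳ b₀ eq))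
                                  (λ eq eb → first-edge-once z s z-path U W eb eq))

      C₁≡ : cycEdges C₁ i j ≡ (p ∨ c)
      C₁≡ = closeTail-edges x t 3≤t x-path x-cross x-closing i j

      C₂≡ : cycEdges C₂ i j ≡ (q ∨ d)
      C₂≡ = closeTail-edges z s 3≤s z-path z-cross z-closing i j

      L-regrouped : L i j ≡ ((p ∨ q) ∨ (a₀ ∨ b₀))
      L-regrouped =
        trans L≡ (solve 4 (λ a₀ p b₀ q → (a₀ :+ p) :+ (b₀ :+ q) := (p :+ q) :+ (a₀ :+ b₀)) refl a₀ p b₀ q)
        where open ∨-∧-Solver

    switch-decomposes : L' i j ≡ (cycEdges C₁ i j ∨ cycEdges C₂ i j)
    switch-decomposes = begin
      L' i j
        ≡⟨ switched i j ⟩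
      L i j xor ((a₀ ∨ b₀) ∨ (c ∨ d))
        ≡⟨ cong (_xor ((a₀ ∨ b₀) ∨ (c ∨ d))) L-regrouped ⟩
      ((p ∨ q) ∨ (a₀ ∨ b₀)) xor ((a₀ ∨ b₀) ∨ (c ∨ d))
        ≡⟨ xor-exchange (p ∨ q) (a₀ ∨ b₀) (c ∨ d) p∨q-vs-a∨b
             (λ eL ecd → Disjointᵇ-∨ˡ c∉L d∉L ecd (trans L-regrouped eL)) ⟩
      (p ∨ q) ∨ (c ∨ d)
        ≡⟨ solve 4 (λ p q c d → (p :+ q) :+ (c :+ d) := (p :+ c) :+ (q :+ d)) refl p q c d ⟩
      (p ∨ c) ∨ (q ∨ d)
        ≡⟨ sym (cong₂ _∨_ C₁≡ C₂≡) ⟩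
      cycEdges C₁ i j ∨ cycEdges C₂ i j ∎
      where
      open ≡-Reasoning
      open ∨-∧-Solver

    switch-cycles-disjoint : ¬ (cycEdges C₁ i j ≡ true × cycEdges C₂ i j ≡ true)
    switch-cycles-disjoint (e₁ , e₂) =
      Disjointᵇ-∨ˡ (Disjointᵇ-∨ʳ (λ ep eq → x-z-disjoint (∨-introʳ a₀ ep) (∨-introʳ b₀ eq))
                                (λ ep ed → d∉L ed (trans L≡ (∨-introˡ (b₀ ∨ q) (∨-introʳ a₀ ep)))))
                   (Disjointᵇ-∨ʳ (λ ec eq → c∉L ec (trans L≡ (∨-introʳ (a₀ ∨ p) (∨-introʳ b₀ eq))))
                                chords-distinct)
        (trans (sym C₁≡) e₁) (trans (sym C₂≡) e₂)

  switch-into-two-cycles : DecompTwoCycles L' t s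
  switch-into-two-cycles = C₁ , C₂ , λ i j → switch-decomposes i j , switch-cycles-disjoint i j


module _ {M : List ℕ} {a b : ℕ} (hab : (Even a × Even b) ⊎ a ≡ b) (P P' : Packing M a b)
         {t : ℕ} {x : ℕ → V a b} (even-t : Even t) (4≤t : 4 ≤ t) (x-path : IsPath x t)
         (x-in-L : PathIn (leave P) x t) (rest : RestIsPath (leave P) x t)
         (x1xt∉L : adjV (leave P) (x 1) (x t) ≡ false)
         (S : SwitchPairing P (x 0) (x t)) (not-terminus : τ S (x 1) ≢ x (t ∸ 1))
         (switched : SwitchedLeave (leave P) (leave P') (x 0) (x t) (x 1) (τ S (x 1))) where

  private
    L L' : EdgeSet a b
    L = leave P
    L' = leave P'

    v : V a b
    v = τ S (x 1)

    0<t : 0 < t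
    0<t = ≤-trans (s≤s z≤n) 4≤t

    x-cross : ∀ k → k < t → crossᵇ (x k) (x (suc k)) ≡ true
    x-cross k k<t = adjV⇒crossᵇ L (x k) (x (suc k)) (x-in-L k k<t)

    x0≢xt : x 0 ≢ x t
    x0≢xt e = <⇒≢ 0<t (x-path 0 t z≤n ≤-refl e)

    same-side : ∀ w → crossᵇ (x 0) w ≡ crossᵇ (x t) w
    same-side = even-path-same-side x t even-t x-cross

    closing = leave-closing-path hab P x t x-path 0<t x-in-L rest
    Z = proj₁ closing
    open PathFromTo Z

    union : PathUnion L x t z len
    union = proj₂ closing

    x1∈X : inX L (x 0) (x t) (x 1) ≡ true
    x1∈X = cong₂ _∧_ (cong₂ _xor_ (x-in-L 0 0<t) (trans (adjV-sym L (x t) (x 1)) x1xt∉L))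
                     (cong₂ (λ p q → not p ∧ not q)
                            (==V-≢ (λ e → case x-path 1 0 0<t z≤n e of λ ()))
                            (==V-≢ (<⇒≢ (≤-trans (s≤s (s≤s z≤n)) 4≤t) ∘ x-path 1 t 0<t ≤-refl)))

    v∈X : inX L (x 0) (x t) v ≡ true
    v∈X = τX S (x 1) x1∈X

    adjV-L : ∀ u w → adjV L u w ≡ (crossᵇ u w ∧ (pathEdges x t u w ∨ pathEdges z len u w))
    adjV-L = adjV-PathUnion {L = L} {x} {z} {t} {len} union

    x0-neighbour : ∀ {w} → adjV L (x 0) w ≡ true → w ≡ x 1 ⊎ w ≡ z 1
    x0-neighbour {w} e =
      Data.Sum.map (start-neighbour x t x-path)
                   (λ on-z → start-neighbour z len z-path
                                (subst (λ r → pathEdges z len r w ≡ true) (sym z-start) on-z))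
                   (∨-true⁻ (pathEdges x t (x 0) w)
                            (proj₂ (∧-true⁻ (crossᵇ (x 0) w) (trans (sym (adjV-L (x 0) w)) e))))

    xt-neighbour : ∀ {w} → adjV L (x t) w ≡ true → w ≡ x (t ∸ 1) ⊎ w ≡ z (len ∸ 1)
    xt-neighbour {w} e =
      Data.Sum.map (end-neighbour x t x-path)
                   (λ on-z → end-neighbour z len z-path
                                (subst (λ r → pathEdges z len r w ≡ true) (sym z-end) on-z))
                   (∨-true⁻ (pathEdges x t (x t) w)
                            (proj₂ (∧-true⁻ (crossᵇ (x t) w) (trans (sym (adjV-L (x t) w)) e))))

    degree-ends : deg L (x 0) ≡ 2 × deg L (x t) ≡ 2
    degree-ends =
      trans (deg-PathUnion L x t z len union (x 0))
            (cong₂ _+_ (proj₁ x-ends) (subst (λ p → pathDegree z len p ≡ 1) z-start (proj₁ z-ends))) ,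
      trans (deg-PathUnion L x t z len union (x t))
            (cong₂ _+_ (proj₂ x-ends) (subst (λ p → pathDegree z len p ≡ 1) z-end (proj₂ z-ends)))
      where
      x-ends = pathDegree-ends x t x-path x-cross x0≢xt
      z-ends = pathDegree-ends z len z-path z-cross (λ e → x0≢xt (trans (sym z-start) (trans e z-end)))

    degree4-kept : ∀ u → deg L u ≡ 4 → deg L' u ≡ 4
    degree4-kept u deg4 with x 0 ≟V u | x t ≟V u
    ... | yes refl | _        = case trans (sym deg4) (proj₁ degree-ends) of λ ()
    ... | no  _    | yes refl = case trans (sym deg4) (proj₂ degree-ends) of λ ()
    ... | no  x0≢u | no  xt≢u =
      trans (switch-preserves-degree switched x0≢xt same-side x1∈X v∈X u x0≢u xt≢u) deg4

    split-along : ∀ {p q} (W : PathFromTo p q) → (p ≡ x 0 × q ≡ x t) ⊎ (p ≡ x t × q ≡ x 0) →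
                  PathUnion L x t (PathFromTo.z W) (PathFromTo.len W) → PathFromTo.z W 1 ≡ v →
                  adjV L q v ≡ false → DecompTwoCycles L' t (size L ∸ t)
    split-along {p} {q} W ends W-union w1≡v qv∉L = subst (DecompTwoCycles L' t) (sym size-eq)
      (switch-into-two-cycles (≤-trans (n≤1+n 3) 4≤t) 3≤n x-path w-path x-cross w-cross W-union
                              (w-ends ends) same-side (trans (adjV-sym L (x t) (x 1)) x1xt∉L)
                              (subst₂ (λ r s → adjV L r s ≡ false) (sym w-end) (sym w1≡v) qv∉L)
                              (λ w1≡x1 → τne S (x 1) x1∈X (trans (sym w1≡v) w1≡x1))
                              (λ i j → trans (switched i j) (cong (L i j xor_) (sym (oriented-toggles i j)))))
      where
      open PathFromTo W
        renaming (len to n; z to w; z-path to w-path; z-start to w-start; z-end to w-end; z-cross to w-cross)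

      size-eq : size L ∸ t ≡ n
      size-eq = trans (cong (_∸ t) (size-PathUnion x-path w-path x-cross w-cross W-union)) (m+n∸m≡n t n)

      q∈ends : q ≡ x 0 ⊎ q ≡ x t
      q∈ends = Data.Sum.map proj₂ proj₂ (Data.Sum.swap ends)

      v∉ends : ∀ {r} → r ≡ x 0 ⊎ r ≡ x t → v ≢ r
      v∉ends (inj₁ refl) = proj₁ (inX-≢ {L = L} {x 0} {x t} v∈X)
      v∉ends (inj₂ refl) = proj₂ (inX-≢ {L = L} {x 0} {x t} v∈X)

      3≤n : 3 ≤ n
      3≤n = three≤length {L = L} w n (PathUnion-second-in {L = L} {x} {w} {t} {n} W-union w-cross)
                         (λ e → p≢q ends (trans (sym w-start) (trans e w-end)))
                         (λ e → v∉ends q∈ends (trans (sym w1≡v) (trans e w-end)))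
                         (subst₂ (λ r s → adjV L r s ≡ false) (sym w-end) (sym w1≡v) qv∉L)
        where
        p≢q : (p ≡ x 0 × q ≡ x t) ⊎ (p ≡ x t × q ≡ x 0) → p ≢ q
        p≢q (inj₁ (refl , refl)) = x0≢xt
        p≢q (inj₂ (refl , refl)) = x0≢xt ∘ sym

      w-ends : (p ≡ x 0 × q ≡ x t) ⊎ (p ≡ x t × q ≡ x 0) → (w 0 ≡ x 0 × w n ≡ x t) ⊎ (w 0 ≡ x t × w n ≡ x 0)
      w-ends = Data.Sum.map (λ (p≡ , q≡) → trans w-start p≡ , trans w-end q≡)
                            (λ (p≡ , q≡) → trans w-start p≡ , trans w-end q≡)

      oriented-toggles : ∀ i j →
        ((sameEdge (x 0) (x 1) (inj₁ i) (inj₂ j) ∨ sameEdge (w 0) (w 1) (inj₁ i) (inj₂ j)) ∨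
         (sameEdge (x t) (x 1) (inj₁ i) (inj₂ j) ∨ sameEdge (w n) (w 1) (inj₁ i) (inj₂ j))) ≡
        switchEdges (x 0) (x t) (x 1) v (inj₁ i) (inj₂ j)
      oriented-toggles i j =
        trans (cong₂ (λ e e' → (sameEdge (x 0) (x 1) (inj₁ i) (inj₂ j) ∨ e) ∨
                               (sameEdge (x t) (x 1) (inj₁ i) (inj₂ j) ∨ e'))
                     (cong₂ (λ r r' → sameEdge r r' (inj₁ i) (inj₂ j)) w-start w1≡v)
                     (cong₂ (λ r r' → sameEdge r r' (inj₁ i) (inj₂ j)) w-end w1≡v))
              (switchEdges-oriented (x 0) (x t) (x 1) v p q ends (inj₁ i) (inj₂ j))

  switch-splits-leave : DecompTwoCycles L' t (size L ∸ t) × numDeg4 L ≤ numDeg4 L'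
  switch-splits-leave = decomposition , numDeg4-mono degree4-kept
    where
    v-adjacent = inX-adjacent {L = L} (x 0) (x t) v v∈X
    decomposition : DecompTwoCycles L' t (size L ∸ t)
    decomposition = oriented (xor-true⁻ (adjV L (x 0) v) _ v-adjacent)
      where
      oriented : adjV L (x 0) v ≡ true ⊎ adjV L (x t) v ≡ true → DecompTwoCycles L' t (size L ∸ t)
      oriented (inj₁ x0v) = from-x0 (x0-neighbour x0v)
        where
        from-x0 : v ≡ x 1 ⊎ v ≡ z 1 → DecompTwoCycles L' t (size L ∸ t)
        from-x0 (inj₁ v≡x1) = ⊥-elim (τne S (x 1) x1∈X v≡x1)
        from-x0 (inj₂ v≡z1) =
          split-along Z (inj₁ (refl , refl)) union (sym v≡z1) (xor-true-excl _ _ v-adjacent x0v)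
      oriented (inj₂ xtv) = from-xt (xt-neighbour xtv)
        where
        from-xt : v ≡ x (t ∸ 1) ⊎ v ≡ z (len ∸ 1) → DecompTwoCycles L' t (size L ∸ t)
        from-xt (inj₁ v≡xt-1) = ⊥-elim (not-terminus v≡xt-1)
        from-xt (inj₂ v≡zn-1) =
          split-along (reverse-PathFromTo Z) (inj₂ (refl , refl))
                      (PathUnion-cong L x t z len (λ i → z (len ∸ i)) len union
                                      (λ u w → cong (crossᵇ u w ∧_) (sym (pathEdges-reverse z len u w))))
                      (sym v≡zn-1)
                      (xor-true-excl _ _ (trans (Boolₚ.xor-comm (adjV L (x t) v) _) v-adjacent) xtv)

lemma2p2 : (M : List ℕ) (a b : ℕ) →
    All (λ m → 0 < m × Even m) M →
    0 < a → 0 < b → (Even a × Even b) ⊎ a ≡ b →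
    (P : Packing M a b) (l : ℕ) → size (leave P) ≡ l →
    OneNontrivialComponent (leave P) →
    (t : ℕ) (x : ℕ → V a b) → Even t → 4 ≤ t →
    IsPath x t → PathIn (leave P) x t →
    RestIsPath (leave P) x t →
    adjV (leave P) (x 1) (x t) ≡ false →
    (S : SwitchPairing P (x 0) (x t)) →
    τ S (x 1) ≢ x (t ∸ 1) →
    (P' : Packing M a b) →
    SwitchedLeave (leave P) (leave P') (x 0) (x t) (x 1) (τ S (x 1)) →
    DecompTwoCycles (leave P') t (l ∸ t) × numDeg4 (leave P) ≤ numDeg4 (leave P')
lemma2p2 M a b _ _ _ hab P l size≡l _ t x even-t 4≤t x-path x-in-L rest x1xt∉L S not-terminus P' switched =
  subst (λ n → DecompTwoCycles (leave P') t (n ∸ t)) size≡l (proj₁ result) , proj₂ result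
  where
  result = switch-splits-leave hab P P' even-t 4≤t x-path x-in-L rest x1xt∉L S not-terminus switched
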